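{- Let $\mathcal{P}=[\overline{a_1,\ldots , a_{k}}]$ be a purely periodic continued fraction with $a_1,\dots,a_k\in\mathbb{Z}[1/p]$. Then $\mathcal{P}$ is $p$-adically convergent if and only if the following conditions are satisfied: \begin{enumerate} \item[(i)] $|A_{k}+B_{k-1}|_p>1$; \item[(ii)] for $j=1,\ldots, k$, if $M(a_j,\dotsc , a_{j+k-1})_{21}=0$ then $|M(a_j,\dotsc , a_{j+k-1})_{22}|_p <1$. \end{enumerate}
   Context: $p$ is a fixed odd prime, $|\cdot|_p$ the $p$-adic absolute value. For a continued fraction $[c_1,c_2,\dots]$ define $A_0=1$, $A_1=c_1$, $A_n=A_{n-1}c_n+A_{n-2}$ and $B_0=0$, $B_1=1$, $B_n=B_{n-1}c_n+B_{n-2}$ for $n\ge 2$; the $n$-th convergent is the point $[A_n:B_n]\in\mathbb{P}^1$, and the continued fraction is $p$-adically convergent if these convergents converge in $\mathbb{P}^1(\mathbb{Q}_p)$. Here the partial quotients are the periodic sequence $a_1,\dots,a_k,a_1,a_2,\dots$ (indices taken modulo $k$, so $a_{j+k}=a_j$). For $c_1,\dots,c_n$, $M(c_1,\dots,c_n)=\prod_{i=1}^n\begin{pmatrix} c_i & 1\\ 1 & 0\end{pmatrix}=\begin{pmatrix} A_n & A_{n-1}\\ B_n & B_{n-1}\end{pmatrix}$ (computed for the continued fraction $[c_1,\dots,c_n]$), and $M(\cdot)_{21},M(\cdot)_{22}$ denote its $(2,1)$ and $(2,2)$ entries. In particular $A_k+B_{k-1}$ is the trace of $M(a_1,\dots,a_k)$.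 -}

module Defs where

open import Data.Nat as ℕ using (ℕ; zero; suc; NonZero; _∸_)
open import Data.Nat.DivMod using (_%_; _/_; _mod_)
open import Data.Integer as ℤ using (ℤ; +_; -[1+_])
open import Data.Rational as ℚ using (ℚ; 0ℚ; 1ℚ; _+_; _*_; _-_; _⊔_; _≤_; _<_; ↥_; ↧ₙ_)
open import Data.Fin using (Fin; toℕ)
open import Data.List using (List; []; _∷_; map; upTo)
open import Data.Product using (∃-syntax; _×_)
open import Relation.Binary.PropositionalEquality using (_≡_)
open import Relation.Nullary using (does)
open import Data.Bool using (if_then_else_)

-- number of factors p in n (computed with fuel; fuel = n suffices for p ≥ 2)
vℕ : (p fuel n : ℕ) → ℕ
vℕ zero    _          _ = 0
vℕ (suc q) zero       _ = 0
vℕ (suc q) (suc fuel) zero = 0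
vℕ (suc q) (suc fuel) n@(suc _) =
  if does (n % suc q ℕ.≟ 0) then suc (vℕ (suc q) fuel (n / suc q)) else 0

-- p-adic valuation of a nonzero rational (value for 0 is irrelevant)
vp : ℕ → ℚ → ℤ
vp p x = + vℕ p ℤ.∣ ↥ x ∣ ℤ.∣ ↥ x ∣ ℤ.- + vℕ p (↧ₙ x) (↧ₙ x)

powℚ : ℚ → ℕ → ℚ
powℚ x zero    = 1ℚ
powℚ x (suc n) = x * powℚ x n

pℚ : ℕ → ℚ
pℚ p = + p ℚ./ 1

pinv : ℕ → ℚ
pinv zero    = 0ℚ
pinv (suc q) = + 1 ℚ./ suc q

pabs : ℕ → ℚ → ℚ
pabs p x with does (x ℚ.≟ 0ℚ)
... | Data.Bool.true  = 0ℚ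
... | Data.Bool.false with vp p x
...   | + n      = powℚ (pinv p) n
...   | -[1+ n ] = powℚ (pℚ p) (suc n)

InZ1p : ℕ → ℚ → Set
InZ1p p x = ∃[ e ] ∃[ z ] (powℚ (pℚ p) e * x ≡ z ℚ./ 1)

-- c n = a_n for n ≥ 1, with a_{j+k} = a_j  (c 0 is unused)
periodic : (k : ℕ) .{{_ : NonZero k}} → (Fin k → ℚ) → ℕ → ℚ
periodic k a n = a ((n ∸ 1) mod k)

A : (ℕ → ℚ) → ℕ → ℚ
A c zero          = 1ℚ
A c (suc zero)    = c 1
A c (suc (suc n)) = A c (suc n) * c (suc (suc n)) + A c n

B : (ℕ → ℚ) → ℕ → ℚ
B c zero          = 0ℚ
B c (suc zero)    = 1ℚ
B c (suc (suc n)) = B c (suc n) * c (suc (suc n)) + B c n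

-- p-adic convergence of the convergents [A_n : B_n] in P¹(ℚ_p), expressed as
-- the Cauchy property for the chordal metric
--   d([a:b],[c:d]) = |ad - bc|_p / (max(|a|_p,|b|_p) · max(|c|_p,|d|_p)),
-- (P¹(ℚ_p) is complete for this metric).
PAdicConvergent : ℕ → (ℕ → ℚ) → Set
PAdicConvergent p c =
  ∀ (ε : ℚ) → 0ℚ < ε → ∃[ N ] (∀ m n → N ℕ.≤ m → N ℕ.≤ n →
    pabs p (A c m * B c n - A c n * B c m)
      ≤ ε * ((pabs p (A c m) ⊔ pabs p (B c m)) * (pabs p (A c n) ⊔ pabs p (B c n))))

record Mat : Set where
  constructor mat
  field
    e11 e12 e21 e22 : ℚ
open Mat public

_⊗_ : Mat → Mat → Mat
mat a b c d ⊗ mat a' b' c' d' =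
  mat (a * a' + b * c') (a * b' + b * d') (c * a' + d * c') (c * b' + d * d')

Id₂ : Mat
Id₂ = mat 1ℚ 0ℚ 0ℚ 1ℚ

M : List ℚ → Mat
M []       = Id₂
M (x ∷ xs) = mat x 1ℚ 1ℚ 0ℚ ⊗ M xs

window : (k : ℕ) .{{_ : NonZero k}} → (Fin k → ℚ) → ℕ → List ℚ
window k a j = map (λ i → periodic k a (j ℕ.+ i)) (upTo k)

-- Everything is proved for an arbitrary non-archimedean absolute value ∣_∣ on ℚ; ∣_∣ₚ is one.
-- Write Xₙ = M(c₁,…,cₙ) = [[Aₙ, Aₙ₋₁], [Bₙ, Bₙ₋₁]] and H(a , b) = max(∣a∣, ∣b∣). As det Xₙ = ±1,
-- consecutive convergents are at chordal distance 1/(Hₙ Hₙ₊₁), and the chordal metric is an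
-- ultrametric, so the continued fraction converges iff Hₙ Hₙ₊₁ → ∞.
-- Along a residue class r mod k, X_{nk+r} = Tⁿ X_r = X_r W_rⁿ with T = M(a₁,…,a_k) and W_r the window
-- starting at a_{r+1}; by Cayley–Hamilton the entries satisfy z_{n+2} = tr T · z_{n+1} − det T · z_n.
-- If ∣tr T∣ ≤ 1 they stay bounded. If ∣tr T∣ > 1 and W_r has a nonzero lower-left entry γ, the
-- cross product of the first columns of X_r and X_{nk+r} starts at 0, ∣γ∣ and then grows like ∣tr T∣ⁿ,
-- so H → ∞ along the class. If γ = 0, W_r is upper triangular with diagonal α, δ and ∣α δ∣ = 1: the
-- first column of X_{nk+r} is scaled by α each period, so for ∣δ∣ < 1 the heights grow geometrically,
-- while for ∣δ∣ ≥ 1 the product of the two column heights of X_{nk+r} stays bounded.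

module Submission where

open import Defs
open import Data.Nat as ℕ using (ℕ; zero; suc; _∸_; NonZero)
open import Data.Nat.Primality using (Prime; euclidsLemma)
open import Data.Fin as Fin using (Fin; toℕ)
import Data.Fin.Properties as Fin
open import Data.Product using (∃₂; ∃-syntax; _×_; _,_; proj₁; proj₂; uncurry)
open import Data.Sum using (inj₁; inj₂; [_,_])
open import Function using (_⇔_; mk⇔; Equivalence)
import Function.Properties.Equivalence as ⇔
open import Data.Product.Function.NonDependent.Propositional using (_×-⇔_)
open import Relation.Nullary using (¬_; yes; no; contradiction)
open import Relation.Binary.PropositionalEquality
  using (_≡_; _≢_; refl; sym; trans; cong; cong₂; subst; subst₂; module ≡-Reasoning)

-- p-adic valuation of natural numbers

module Valuation (q : ℕ) (isPrime : Prime (suc (suc q))) where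
  open import Data.Nat
  open import Data.Nat.Properties
  open import Data.Nat.Divisibility
  open import Data.Nat.DivMod using (_%_; _/_; m*n/n≡m)
  open import Data.Nat.Induction using (<-rec)
  open import Data.Nat.Solver using (module +-*-Solver)
  import Data.Integer as ℤ
  import Data.Integer.Divisibility.Signed as ℤ

  P : ℕ
  P = suc (suc q)

  v : ℕ → ℕ
  v n = vℕ P n n

  private
    vℕ-∣ : ∀ f m → P ∣ suc m → vℕ P (suc f) (suc m) ≡ suc (vℕ P f (suc m / P))
    vℕ-∣ f m P∣ with suc m % P | n∣m⇒m%n≡0 (suc m) P P∣
    ... | .0 | refl = refl

    vℕ-∤ : ∀ f m → P ∤ suc m → vℕ P (suc f) (suc m) ≡ 0
    vℕ-∤ f m P∤ with suc m % P in eq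
    ... | zero  = contradiction (m%n≡0⇒n∣m (suc m) P eq) P∤
    ... | suc _ = refl

    ∤⇒nonZero : ∀ {u} → P ∤ u → NonZero u
    ∤⇒nonZero {zero}  P∤u = contradiction (P ∣0) P∤u
    ∤⇒nonZero {suc u} _   = _

    vℕ-P* : ∀ f n .{{_ : NonZero n}} → vℕ P (suc f) (P * n) ≡ suc (vℕ P f n)
    vℕ-P* f (suc n) = trans (vℕ-∣ f _ (m∣m*n (suc n))) (cong (λ x → suc (vℕ P f x)) (trans (cong (_/ P) (*-comm P (suc n))) (m*n/n≡m (suc n) P)))

    vℕ-P^e*u : ∀ {f} e {u} → P ∤ u → e ≤ f → vℕ P f (P ^ e * u) ≡ e
    vℕ-P^e*u {zero}  zero    P∤u _ = refl
    vℕ-P^e*u {suc f} zero {zero}  P∤u _ = contradiction (P ∣0) P∤u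
    vℕ-P^e*u {suc f} zero {suc m} P∤u _ rewrite +-identityʳ m = vℕ-∤ f m P∤u
    vℕ-P^e*u {suc f} (suc e) {u} P∤u (s≤s e≤f) = begin
      vℕ P (suc f) (P ^ suc e * u)   ≡⟨ cong (vℕ P (suc f)) (*-assoc P (P ^ e) u) ⟩
      vℕ P (suc f) (P * (P ^ e * u)) ≡⟨ vℕ-P* f (P ^ e * u) {{m*n≢0 (P ^ e) u {{m^n≢0 P e}} {{∤⇒nonZero P∤u}}}} ⟩
      suc (vℕ P f (P ^ e * u))       ≡⟨ cong suc (vℕ-P^e*u e P∤u e≤f) ⟩
      suc e                          ∎
      where open ≡-Reasoning

    n<P^n : ∀ n → n < P ^ n
    n<P^n zero    = s≤s z≤n
    n<P^n (suc n) = begin-strict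
      suc n            ≤⟨ n<P^n n ⟩
      P ^ n            <⟨ m<m+n (P ^ n) (m^n>0 P n) ⟩
      P ^ n + P ^ n    ≤⟨ +-monoʳ-≤ (P ^ n) (m≤m+n (P ^ n) (q * P ^ n)) ⟩
      P ^ suc n        ∎
      where open ≤-Reasoning

  v-P^e*u : ∀ e {u} → P ∤ u → v (P ^ e * u) ≡ e
  v-P^e*u e {u} P∤u = vℕ-P^e*u e P∤u (≤-trans (<⇒≤ (n<P^n e)) (m≤m*n (P ^ e) u {{∤⇒nonZero P∤u}}))

  Factorisation : ℕ → Set
  Factorisation n = ∃₂ λ e u → P ∤ u × n ≡ P ^ e * u

  factorise : ∀ n .{{_ : NonZero n}} → Factorisation n
  factorise = <-rec (λ n → .{{NonZero n}} → Factorisation n) go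
    where
    go : ∀ n → (∀ {m} → m < n → .{{NonZero m}} → Factorisation m) → .{{NonZero n}} → Factorisation n
    go n rec with P ∣? n
    ... | no P∤n = 0 , n , P∤n , sym (*-identityˡ n)
    ... | yes P∣n@(divides m n≡m*P) with rec (quotient-< P∣n) {{quotient≢0 P∣n}}
    ...   | e , u , P∤u , m≡ = suc e , u , P∤u , (begin
      n                ≡⟨ n≡m*P ⟩
      m * P            ≡⟨ cong (_* P) m≡ ⟩
      P ^ e * u * P    ≡⟨ solve 3 (λ x y z → x :* y :* z := z :* x :* y) refl (P ^ e) u P ⟩
      P ^ suc e * u    ∎)
      where
      open ≡-Reasoning
      open +-*-Solver

  v-factorisation : ∀ {n} → (s : Factorisation n) → v n ≡ proj₁ s
  v-factorisation (e , u , P∤u , refl) = v-P^e*u e P∤u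

  v-* : ∀ m n .{{_ : NonZero m}} .{{_ : NonZero n}} → v (m * n) ≡ v m + v n
  v-* m n with factorise m | factorise n
  ... | s@(e , u , P∤u , refl) | t@(f , w , P∤w , refl) = begin
    v (P ^ e * u * (P ^ f * w))  ≡⟨ cong v (solve 4 (λ x y z t → x :* z :* (y :* t) := x :* y :* (z :* t)) refl (P ^ e) (P ^ f) u w) ⟩
    v (P ^ e * P ^ f * (u * w))  ≡⟨ cong (λ x → v (x * (u * w))) (sym (^-distribˡ-+-* P e f)) ⟩
    v (P ^ (e + f) * (u * w))    ≡⟨ v-P^e*u (e + f) P∤uw ⟩
    e + f                        ≡⟨ sym (cong₂ _+_ (v-factorisation s) (v-factorisation t)) ⟩
    v (P ^ e * u) + v (P ^ f * w) ∎
    where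
    open ≡-Reasoning
    open +-*-Solver
    P∤uw : P ∤ u * w
    P∤uw P∣uw = [ P∤u , P∤w ] (euclidsLemma u w isPrime P∣uw)

  private
    ^-monoʳ-∣ : ∀ {a b} → a ≤ b → P ^ a ∣ P ^ b
    ^-monoʳ-∣ {a} {b} a≤b = divides (P ^ (b ∸ a)) (begin
      P ^ b                ≡⟨ cong (P ^_) (sym (m∸n+n≡m a≤b)) ⟩
      P ^ (b ∸ a + a)      ≡⟨ ^-distribˡ-+-* P (b ∸ a) a ⟩
      P ^ (b ∸ a) * P ^ a  ∎)
      where open ≡-Reasoning

  P^v∣ : ∀ n → P ^ v n ∣ n
  P^v∣ zero = _ ∣0
  P^v∣ n@(suc _) with factorise n
  ... | s@(e , u , _ , n≡) rewrite v-factorisation s = divides u (trans n≡ (*-comm (P ^ e) u))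

  P^e∣⇒e≤v : ∀ {e} n .{{_ : NonZero n}} → P ^ e ∣ n → e ≤ v n
  P^e∣⇒e≤v {e} n P^e∣n with factorise n
  ... | s@(f , u , P∤u , n≡) rewrite v-factorisation s with e ≤? f
  ...   | yes e≤f = e≤f
  ...   | no  e≰f = contradiction P∣u P∤u
    where
    P^f*P∣P^f*u : P ^ f * P ∣ P ^ f * u
    P^f*P∣P^f*u = subst₂ _∣_ (*-comm P (P ^ f)) n≡ (∣-trans (^-monoʳ-∣ (≰⇒> e≰f)) P^e∣n)
    P∣u : P ∣ u
    P∣u = *-cancelˡ-∣ (P ^ f) {{m^n≢0 P f}} P^f*P∣P^f*u

  v-+ : ∀ i j .{{_ : NonZero ℤ.∣ i ℤ.+ j ∣}} → v ℤ.∣ i ∣ ⊓ v ℤ.∣ j ∣ ≤ v ℤ.∣ i ℤ.+ j ∣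
  v-+ i j = P^e∣⇒e≤v _ (ℤ.∣⇒∣ᵤ (ℤ.∣m∣n⇒∣m+n (P^min∣ i (m⊓n≤m _ _)) (P^min∣ j (m⊓n≤n _ _))))
    where
    P^min∣ : ∀ k → v ℤ.∣ i ∣ ⊓ v ℤ.∣ j ∣ ≤ v ℤ.∣ k ∣ → ℤ.+ (P ^ (v ℤ.∣ i ∣ ⊓ v ℤ.∣ j ∣)) ℤ.∣ k
    P^min∣ k ≤v = ℤ.∣ᵤ⇒∣ (∣-trans (^-monoʳ-∣ ≤v) (P^v∣ ℤ.∣ k ∣))

-- Inequalities in ℚ and divergence to infinity

import Data.Nat.Properties as ℕ
import Data.Nat.Divisibility as ℕ
open import Data.Integer as ℤ using (+_)
import Data.Integer.Properties as ℤ
open import Data.Rational as ℚ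
  using (ℚ; mkℚ; 0ℚ; 1ℚ; _+_; _*_; _-_; -_; _≤_; _<_; _⊔_; ↥_; ↧ₙ_; toℚᵘ)
import Data.Rational.Properties as ℚ
import Data.Rational.Unnormalised as ℚᵘ
import Data.Rational.Unnormalised.Properties as ℚᵘ
import Data.Rational.Solver as ℚ-Solver
import Data.Integer.Solver as ℤ-Solver
import Data.Nat.Solver as ℕ-Solver
import Data.Nat.Coprimality as Coprime

*-nonNeg : ∀ {a b} → 0ℚ ≤ a → 0ℚ ≤ b → 0ℚ ≤ a * b
*-nonNeg {a} {b} 0≤a 0≤b =
  ℚ.nonNegative⁻¹ _ {{ℚ.nonNeg*nonNeg⇒nonNeg a {{ℚ.nonNegative 0≤a}} b {{ℚ.nonNegative 0≤b}}}}

*-pos : ∀ {a b} → 0ℚ < a → 0ℚ < b → 0ℚ < a * b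
*-pos {a} {b} 0<a 0<b = ℚ.positive⁻¹ _ {{ℚ.pos*pos⇒pos a {{ℚ.positive 0<a}} b {{ℚ.positive 0<b}}}}

*-mono-≤-nonNeg : ∀ {a b c d} → 0ℚ ≤ a → 0ℚ ≤ c → a ≤ b → c ≤ d → a * c ≤ b * d
*-mono-≤-nonNeg {a} {b} {c} {d} 0≤a 0≤c a≤b c≤d = ℚ.≤-trans
  (ℚ.*-monoʳ-≤-nonNeg c {{ℚ.nonNegative 0≤c}} a≤b)
  (ℚ.*-monoˡ-≤-nonNeg b {{ℚ.nonNegative (ℚ.≤-trans 0≤a a≤b)}} c≤d)

<⇒≱ : ∀ {a b} → a < b → ¬ b ≤ a
<⇒≱ a<b b≤a = ℚ.<-irrefl refl (ℚ.<-≤-trans a<b b≤a)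

0≤1 : 0ℚ ≤ 1ℚ
0≤1 = ℚ.nonNegative⁻¹ 1ℚ

0<1 : 0ℚ < 1ℚ
0<1 = ℚ.positive⁻¹ 1ℚ

a*b≡1⇒a≤1 : ∀ {a b} → 0ℚ ≤ a → 1ℚ ≤ b → a * b ≡ 1ℚ → a ≤ 1ℚ
a*b≡1⇒a≤1 {a} {b} 0≤a 1≤b ab≡1 with 1ℚ ℚ.<? a
... | no  1≮a = ℚ.≮⇒≥ 1≮a
... | yes 1<a = contradiction (ℚ.≤-reflexive ab≡1) (<⇒≱ (ℚ.<-≤-trans 1<a a≤ab))
  where
  a≤ab : a ≤ a * b
  a≤ab = subst (_≤ a * b) (ℚ.*-identityʳ a) (ℚ.*-monoˡ-≤-nonNeg a {{ℚ.nonNegative 0≤a}} 1≤b)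

a*b≡1⇒1<a : ∀ {a b} → 0ℚ ≤ b → b < 1ℚ → a * b ≡ 1ℚ → 1ℚ < a
a*b≡1⇒1<a {a} {b} 0≤b b<1 ab≡1 with 1ℚ ℚ.<? a
... | yes 1<a = 1<a
... | no  1≮a = contradiction (ℚ.≤-reflexive (sym ab≡1)) (<⇒≱ (ℚ.≤-<-trans ab≤b b<1))
  where
  ab≤b : a * b ≤ b
  ab≤b = subst (a * b ≤_) (ℚ.*-identityˡ b) (ℚ.*-monoʳ-≤-nonNeg b {{ℚ.nonNegative 0≤b}} (ℚ.≮⇒≥ 1≮a))

1≤a*b⇒0<a : ∀ {a b} → 0ℚ ≤ b → 1ℚ ≤ a * b → 0ℚ < a
1≤a*b⇒0<a {a} {b} 0≤b 1≤ab with 0ℚ ℚ.<? a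
... | yes 0<a = 0<a
... | no  0≮a = contradiction (ℚ.≤-trans 1≤ab ab≤0) (<⇒≱ 0<1)
  where
  ab≤0 : a * b ≤ 0ℚ
  ab≤0 = subst (a * b ≤_) (ℚ.*-zeroˡ b) (ℚ.*-monoʳ-≤-nonNeg b {{ℚ.nonNegative 0≤b}} (ℚ.≮⇒≥ 0≮a))

x≤x+y : ∀ x {y} → 0ℚ ≤ y → x ≤ x + y
x≤x+y x 0≤y = subst (_≤ x + _) (ℚ.+-identityʳ x) (ℚ.+-monoʳ-≤ x 0≤y)

0≤x-1 : ∀ {x} → 1ℚ ≤ x → 0ℚ ≤ x - 1ℚ
0≤x-1 {x} 1≤x = subst (_≤ x - 1ℚ) (ℚ.+-inverseʳ 1ℚ) (ℚ.+-monoˡ-≤ (- 1ℚ) 1≤x)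

0<x-1 : ∀ {x} → 1ℚ < x → 0ℚ < x - 1ℚ
0<x-1 {x} 1<x = subst (_< x - 1ℚ) (ℚ.+-inverseʳ 1ℚ) (ℚ.+-monoˡ-< (- 1ℚ) 1<x)

pow-+ : ∀ x m n → powℚ x (m ℕ.+ n) ≡ powℚ x m * powℚ x n
pow-+ x zero    n = sym (ℚ.*-identityˡ (powℚ x n))
pow-+ x (suc m) n = trans (cong (x *_) (pow-+ x m n)) (sym (ℚ.*-assoc x (powℚ x m) (powℚ x n)))

pow-* : ∀ x y n → powℚ (x * y) n ≡ powℚ x n * powℚ y n
pow-* x y zero    = refl
pow-* x y (suc n) = trans (cong (x * y *_) (pow-* x y n))
  (solve 4 (λ x y a b → (x :* y) :* (a :* b) := (x :* a) :* (y :* b)) refl x y (powℚ x n) (powℚ y n))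
  where open ℚ-Solver.+-*-Solver

pow-1ℚ : ∀ n → powℚ 1ℚ n ≡ 1ℚ
pow-1ℚ zero    = refl
pow-1ℚ (suc n) = trans (ℚ.*-identityˡ (powℚ 1ℚ n)) (pow-1ℚ n)

pow-pos : ∀ {x} n → 0ℚ < x → 0ℚ < powℚ x n
pow-pos zero    _   = 0<1
pow-pos (suc n) 0<x = *-pos 0<x (pow-pos n 0<x)

pow-≥1 : ∀ {x} n → 1ℚ ≤ x → 1ℚ ≤ powℚ x n
pow-≥1 zero    _   = ℚ.≤-refl
pow-≥1 (suc n) 1≤x = *-mono-≤-nonNeg 0≤1 0≤1 1≤x (pow-≥1 n 1≤x)

fromℕ : ℕ → ℚ
fromℕ n = mkℚ (+ n) 0 (Coprime.sym (Coprime.1-coprimeTo n))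

fromℕ-mono : ∀ {m n} → m ℕ.≤ n → fromℕ m ≤ fromℕ n
fromℕ-mono {m} {n} m≤n = ℚ.*≤* (subst₂ ℤ._≤_ (sym (ℤ.*-identityʳ (+ m))) (sym (ℤ.*-identityʳ (+ n))) (ℤ.+≤+ m≤n))

fromℕ-suc : ∀ n → fromℕ (suc n) ≡ 1ℚ + fromℕ n
fromℕ-suc n = ℚ.toℚᵘ-injective (ℚᵘ.≃-sym (ℚᵘ.≃-trans (ℚ.toℚᵘ-homo-+ 1ℚ (fromℕ n)) (ℚᵘ.*≡*
  (solve 1 (λ n → (con (+ 1) :* con (+ 1) :+ n :* con (+ 1)) :* con (+ 1) := (con (+ 1) :+ n) :* con (+ 1)) refl (+ n)))))
  where open ℤ-Solver.+-*-Solver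

archimedean : ∀ x → ∃[ n ] x ≤ fromℕ n
archimedean (mkℚ (+ n)    d _) = n , ℚ.*≤* (ℤ.*-monoˡ-≤-nonNeg (+ n) (ℤ.+≤+ (ℕ.s≤s ℕ.z≤n)))
archimedean (mkℚ ℤ.-[1+ n ] d _) = 0 , ℚ.*≤* ℤ.-≤+

bernoulli : ∀ {r} → 1ℚ ≤ r → ∀ n → 1ℚ + fromℕ n * (r - 1ℚ) ≤ powℚ r n
bernoulli {r} 1≤r zero = ℚ.≤-reflexive (trans (cong (λ x → 1ℚ + x) (ℚ.*-zeroˡ (r - 1ℚ))) (ℚ.+-identityʳ 1ℚ))
bernoulli {r} 1≤r (suc n) = begin
  1ℚ + fromℕ (suc n) * s          ≡⟨ cong (λ x → 1ℚ + x * s) (fromℕ-suc n) ⟩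
  1ℚ + (1ℚ + N) * s               ≤⟨ x≤x+y _ (*-nonNeg (*-nonNeg (fromℕ-mono ℕ.z≤n) 0≤s) 0≤s) ⟩
  1ℚ + (1ℚ + N) * s + N * s * s   ≡⟨ solve 2 (λ r N → con 1ℚ :+ (con 1ℚ :+ N) :* (r :- con 1ℚ) :+ N :* (r :- con 1ℚ) :* (r :- con 1ℚ)
                                                   := r :* (con 1ℚ :+ N :* (r :- con 1ℚ))) refl r N ⟩
  r * (1ℚ + N * s)                ≤⟨ ℚ.*-monoˡ-≤-nonNeg r {{ℚ.nonNegative (ℚ.≤-trans 0≤1 1≤r)}} (bernoulli 1≤r n) ⟩
  r * powℚ r n                    ∎
  where
  open ℚ.≤-Reasoning
  open ℚ-Solver.+-*-Solver
  N = fromℕ n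
  s = r - 1ℚ
  0≤s : 0ℚ ≤ s
  0≤s = 0≤x-1 1≤r

Eventually : (ℕ → Set) → Set
Eventually P = ∃[ N ] ∀ n → N ℕ.≤ n → P n

TendsToInfinity : (ℕ → ℚ) → Set
TendsToInfinity f = ∀ B → Eventually (λ n → B ≤ f n)

module _ {P Q : ℕ → Set} where

  eventually-map : (∀ {n} → P n → Q n) → Eventually P → Eventually Q
  eventually-map P⇒Q (N , ev) = N , λ n N≤n → P⇒Q (ev n N≤n)

  eventually-× : Eventually P → Eventually Q → Eventually (λ n → P n × Q n)
  eventually-× (M , evP) (N , evQ) = M ℕ.⊔ N , λ n M⊔N≤n →
    evP n (ℕ.≤-trans (ℕ.m≤m⊔n M N) M⊔N≤n) , evQ n (ℕ.≤-trans (ℕ.m≤n⊔m M N) M⊔N≤n)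

eventually-suc⁻ : ∀ {P} → Eventually (λ n → P (suc n)) → Eventually P
eventually-suc⁻ (N , ev) = suc N , λ { (suc n) (ℕ.s≤s N≤n) → ev n N≤n }

eventually-∘ : ∀ {P} {σ : ℕ → ℕ} → (∀ n → n ℕ.≤ σ n) → Eventually P → Eventually (λ n → P (σ n))
eventually-∘ n≤σn (N , ev) = N , λ n N≤n → ev _ (ℕ.≤-trans N≤n (n≤σn n))

eventually-∀< : ∀ {P : ℕ → ℕ → Set} b → (∀ r → r ℕ.< b → Eventually (P r)) →
                Eventually (λ n → ∀ r → r ℕ.< b → P r n)
eventually-∀< zero    _  = 0 , λ _ _ _ ()
eventually-∀< {P} (suc b) ev = eventually-map split (eventually-× (eventually-∀< b (λ r r<b → ev r (ℕ.m<n⇒m<1+n r<b))) (ev b ℕ.≤-refl))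
  where
  split : ∀ {n} → (∀ r → r ℕ.< b → P r n) × P b n → ∀ r → r ℕ.< suc b → P r n
  split (below , at) r r<1+b with ℕ.m<1+n⇒m<n∨m≡n r<1+b
  ... | inj₁ r<b  = below r r<b
  ... | inj₂ refl = at

eventually-residues : ∀ {P} k .{{_ : NonZero k}} →
                      Eventually (λ n → ∀ r → r ℕ.< k → P (n ℕ.* k ℕ.+ r)) → Eventually P
eventually-residues {P} k (N , ev) = N ℕ.* k , λ i N*k≤i →
  subst P (i≡ i) (ev (i / k) (subst (ℕ._≤ i / k) (m*n/n≡m N k) (/-monoˡ-≤ k N*k≤i)) (i % k) (m%n<n i k))
  where
  open import Data.Nat.DivMod using (_/_; _%_; m≡m%n+[m/n]*n; m%n<n; m*n/n≡m; /-monoˡ-≤)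
  i≡ : ∀ i → i / k ℕ.* k ℕ.+ i % k ≡ i
  i≡ i = trans (ℕ.+-comm (i / k ℕ.* k) (i % k)) (sym (m≡m%n+[m/n]*n i k))

→∞-mono : ∀ {f g} → (∀ n → f n ≤ g n) → TendsToInfinity f → TendsToInfinity g
→∞-mono f≤g f→∞ B = eventually-map (λ {n} B≤fn → ℚ.≤-trans B≤fn (f≤g n)) (f→∞ B)

→∞-suc⁻ : ∀ {f} → TendsToInfinity (λ n → f (suc n)) → TendsToInfinity f
→∞-suc⁻ f→∞ B = eventually-suc⁻ (f→∞ B)

→∞-∘ : ∀ {f} {σ : ℕ → ℕ} → (∀ n → n ℕ.≤ σ n) → TendsToInfinity f → TendsToInfinity (λ n → f (σ n))
→∞-∘ n≤σn f→∞ B = eventually-∘ n≤σn (f→∞ B)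

→∞-residues : ∀ {f} k .{{_ : NonZero k}} →
              (∀ r → r ℕ.< k → TendsToInfinity (λ n → f (n ℕ.* k ℕ.+ r))) → TendsToInfinity f
→∞-residues k f→∞ B = eventually-residues k (eventually-∀< k (λ r r<k → f→∞ r r<k B))

→∞-* : ∀ {f g} → TendsToInfinity f → TendsToInfinity g → TendsToInfinity (λ n → f n * g n)
→∞-* {f} {g} f→∞ g→∞ B = eventually-map bound (eventually-× (f→∞ B′) (g→∞ B′))
  where
  B′ = 1ℚ ⊔ B
  0≤B′ : 0ℚ ≤ B′
  0≤B′ = ℚ.≤-trans 0≤1 (ℚ.p≤p⊔q 1ℚ B)
  bound : ∀ {n} → B′ ≤ f n × B′ ≤ g n → B ≤ f n * g n
  bound {n} (B′≤f , B′≤g) = begin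
    B         ≤⟨ ℚ.p≤q⊔p 1ℚ B ⟩
    B′        ≡⟨ sym (ℚ.*-identityˡ B′) ⟩
    1ℚ * B′   ≤⟨ *-mono-≤-nonNeg 0≤1 0≤B′ (ℚ.p≤p⊔q 1ℚ B) ℚ.≤-refl ⟩
    B′ * B′   ≤⟨ *-mono-≤-nonNeg 0≤B′ 0≤B′ B′≤f B′≤g ⟩
    f n * g n ∎
    where open ℚ.≤-Reasoning

→∞-unbounded : ∀ {f} → TendsToInfinity f → ∀ K → ¬ (∀ n → f n ≤ K)
→∞-unbounded f→∞ K f≤K with f→∞ (1ℚ + K)
... | N , ev = <⇒≱ K<1+K (ℚ.≤-trans (ev N ℕ.≤-refl) (f≤K N))
  where
  K<1+K : K < 1ℚ + K
  K<1+K = subst (_< 1ℚ + K) (ℚ.+-identityˡ K) (ℚ.+-monoˡ-< K 0<1)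

pow→∞ : ∀ {r C} → 1ℚ < r → 0ℚ < C → TendsToInfinity (λ n → C * powℚ r n)
pow→∞ {r} {C} 1<r 0<C B = N , λ n N≤n → begin
  B                        ≡⟨ B≡B/e*e ⟩
  B * ℚ.1/ e * e           ≤⟨ ℚ.*-monoʳ-≤-nonNeg e {{ℚ.nonNegative (ℚ.<⇒≤ 0<e)}} (ℚ.≤-trans B/e≤N (fromℕ-mono N≤n)) ⟩
  fromℕ n * e              ≡⟨ solve 3 (λ n C s → n :* (C :* s) := C :* (n :* s)) refl (fromℕ n) C s ⟩
  C * (fromℕ n * s)        ≤⟨ C*-mono (subst (fromℕ n * s ≤_) (ℚ.+-comm (fromℕ n * s) 1ℚ) (x≤x+y _ 0≤1)) ⟩
  C * (1ℚ + fromℕ n * s)   ≤⟨ C*-mono (bernoulli (ℚ.<⇒≤ 1<r) n) ⟩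
  C * powℚ r n             ∎
  where
  open ℚ.≤-Reasoning
  open ℚ-Solver.+-*-Solver
  s = r - 1ℚ
  e = C * s
  0<e : 0ℚ < e
  0<e = *-pos 0<C (0<x-1 1<r)
  instance
    e≢0 : ℚ.NonZero e
    e≢0 = ℚ.pos⇒nonZero e {{ℚ.positive 0<e}}
  N = proj₁ (archimedean (B * ℚ.1/ e))
  B/e≤N : B * ℚ.1/ e ≤ fromℕ N
  B/e≤N = proj₂ (archimedean (B * ℚ.1/ e))
  B≡B/e*e : B ≡ B * ℚ.1/ e * e
  B≡B/e*e = sym (trans (ℚ.*-assoc B _ e) (trans (cong (B *_) (ℚ.*-inverseˡ e)) (ℚ.*-identityʳ B)))
  C*-mono : ∀ {x y} → x ≤ y → C * x ≤ C * y
  C*-mono = ℚ.*-monoˡ-≤-nonNeg C {{ℚ.nonNegative (ℚ.<⇒≤ 0<C)}}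

→∞-geometric : ∀ {f r C D} → 1ℚ < r → 0ℚ < C → 0ℚ < D → (∀ n → C * powℚ r n ≤ D * f n) → TendsToInfinity f
→∞-geometric {D = D} 1<r 0<C 0<D bound B = eventually-map
  (λ {n} DB≤ → ℚ.*-cancelˡ-≤-pos D {{ℚ.positive 0<D}} (ℚ.≤-trans DB≤ (bound n)))
  (pow→∞ 1<r 0<C (D * B))

-- The p-adic absolute value

record IsNonArchimedeanAbsoluteValue (∣_∣ : ℚ → ℚ) : Set where
  field
    ∣0∣≡0         : ∣ 0ℚ ∣ ≡ 0ℚ
    x≢0⇒0<∣x∣     : ∀ {x} → x ≢ 0ℚ → 0ℚ < ∣ x ∣
    ∣1∣≡1         : ∣ 1ℚ ∣ ≡ 1ℚ
    ∣-x∣≡∣x∣      : ∀ x → ∣ - x ∣ ≡ ∣ x ∣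
    ∣x*y∣≡∣x∣*∣y∣ : ∀ x y → ∣ x * y ∣ ≡ ∣ x ∣ * ∣ y ∣
    ∣x+y∣≤∣x∣⊔∣y∣ : ∀ x y → ∣ x + y ∣ ≤ ∣ x ∣ ⊔ ∣ y ∣

module PAdicAbsoluteValue (q : ℕ) (isPrime : Prime (suc (suc q))) where
  open Valuation q isPrime using (P; v; v-*; v-+; v-P^e*u)

  private
    toℚᵘ-/ : ∀ n d → toℚᵘ (n ℚ./ suc d) ℚᵘ.≃ ℚᵘ.mkℚᵘ n d
    toℚᵘ-/ n d = ℚ.toℚᵘ-fromℚᵘ (ℚᵘ.mkℚᵘ n d)

    pinv*p : pinv P * pℚ P ≡ 1ℚ
    pinv*p = ℚ.toℚᵘ-injective (begin
      toℚᵘ (pinv P * pℚ P)                       ≈⟨ ℚ.toℚᵘ-homo-* (pinv P) (pℚ P) ⟩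
      toℚᵘ (pinv P) ℚᵘ.* toℚᵘ (pℚ P)              ≈⟨ ℚᵘ.*-cong (toℚᵘ-/ (+ 1) (suc q)) (toℚᵘ-/ (+ P) 0) ⟩
      ℚᵘ.1/ ℚᵘ.mkℚᵘ (+ P) 0 ℚᵘ.* ℚᵘ.mkℚᵘ (+ P) 0  ≈⟨ ℚᵘ.*-inverseˡ (ℚᵘ.mkℚᵘ (+ P) 0) ⟩
      ℚᵘ.1ℚᵘ                                     ∎)
      where open ℚᵘ.≃-Reasoning

    1≤p : 1ℚ ≤ pℚ P
    1≤p = ℚ.toℚᵘ-cancel-≤ (ℚᵘ.≤-respʳ-≃ (ℚᵘ.≃-sym (toℚᵘ-/ (+ P) 0)) (ℚᵘ.*≤* (ℤ.+≤+ (ℕ.s≤s ℕ.z≤n))))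

    0<pinv : 0ℚ < pinv P
    0<pinv = ℚ.toℚᵘ-cancel-< (ℚᵘ.<-respʳ-≃ (ℚᵘ.≃-sym (toℚᵘ-/ (+ 1) (suc q))) (ℚᵘ.*<* (ℤ.+<+ (ℕ.s≤s ℕ.z≤n))))

  -- pPow a b = p ^ (b - a), kept as a pair of exponents to avoid integer powers.
  pPow : ℕ → ℕ → ℚ
  pPow a b = powℚ (pinv P) a * powℚ (pℚ P) b

  pPow-* : ∀ a b a′ b′ → pPow a b * pPow a′ b′ ≡ pPow (a ℕ.+ a′) (b ℕ.+ b′)
  pPow-* a b a′ b′ = begin
    (x ^ a * y ^ b) * (x ^ a′ * y ^ b′)  ≡⟨ interchange (x ^ a) (y ^ b) (x ^ a′) (y ^ b′) ⟩
    (x ^ a * x ^ a′) * (y ^ b * y ^ b′)  ≡⟨ sym (cong₂ _*_ (pow-+ x a a′) (pow-+ y b b′)) ⟩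
    pPow (a ℕ.+ a′) (b ℕ.+ b′)           ∎
    where
    open ≡-Reasoning
    open ℚ-Solver.+-*-Solver
    x = pinv P
    y = pℚ P
    _^_ = powℚ
    interchange : ∀ u v s t → (u * v) * (s * t) ≡ (u * s) * (v * t)
    interchange = solve 4 (λ u v s t → (u :* v) :* (s :* t) := (u :* s) :* (v :* t)) refl

  pPow-cancel : ∀ a b c → pPow (a ℕ.+ c) (b ℕ.+ c) ≡ pPow a b
  pPow-cancel a b c = begin
    pPow (a ℕ.+ c) (b ℕ.+ c)   ≡⟨ sym (pPow-* a b c c) ⟩
    pPow a b * pPow c c        ≡⟨ cong (pPow a b *_) (sym (pow-* (pinv P) (pℚ P) c)) ⟩
    pPow a b * powℚ (pinv P * pℚ P) c  ≡⟨ cong (λ x → pPow a b * powℚ x c) pinv*p ⟩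
    pPow a b * powℚ 1ℚ c       ≡⟨ cong (pPow a b *_) (pow-1ℚ c) ⟩
    pPow a b * 1ℚ              ≡⟨ ℚ.*-identityʳ (pPow a b) ⟩
    pPow a b                   ∎
    where open ≡-Reasoning

  pPow-cong : ∀ {a b a′ b′} → a ℕ.+ b′ ≡ a′ ℕ.+ b → pPow a b ≡ pPow a′ b′
  pPow-cong {a} {b} {a′} {b′} eq = begin
    pPow a b                     ≡⟨ sym (pPow-cancel a b b′) ⟩
    pPow (a ℕ.+ b′) (b ℕ.+ b′)   ≡⟨ cong₂ pPow eq (ℕ.+-comm b b′) ⟩
    pPow (a′ ℕ.+ b) (b′ ℕ.+ b)   ≡⟨ pPow-cancel a′ b′ b ⟩
    pPow a′ b′                   ∎
    where open ≡-Reasoning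

  pPow-pos : ∀ a b → 0ℚ < pPow a b
  pPow-pos a b = *-pos (pow-pos a 0<pinv) (pow-pos b (ℚ.<-≤-trans 0<1 1≤p))

  pPow-antitone : ∀ {a a′} b → a′ ℕ.≤ a → pPow a b ≤ pPow a′ b
  pPow-antitone {a} {a′} b a′≤a = begin
    pPow a b                          ≡⟨ sym (ℚ.*-identityʳ (pPow a b)) ⟩
    pPow a b * 1ℚ                     ≤⟨ ℚ.*-monoˡ-≤-nonNeg (pPow a b) {{ℚ.nonNegative (ℚ.<⇒≤ (pPow-pos a b))}} 1≤pPow0d ⟩
    pPow a b * pPow 0 d               ≡⟨ pPow-* a b 0 d ⟩
    pPow (a ℕ.+ 0) (b ℕ.+ d)          ≡⟨ pPow-cong {a ℕ.+ 0} {b ℕ.+ d} {a′} {b} exponents ⟩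
    pPow a′ b                         ∎
    where
    open ℚ.≤-Reasoning
    d = a ℕ.∸ a′
    1≤pPow0d : 1ℚ ≤ pPow 0 d
    1≤pPow0d = subst (1ℚ ≤_) (sym (ℚ.*-identityˡ _)) (pow-≥1 d 1≤p)
    exponents : a ℕ.+ 0 ℕ.+ b ≡ a′ ℕ.+ (b ℕ.+ d)
    exponents = trans (cong (λ x → x ℕ.+ 0 ℕ.+ b) (sym (ℕ.m+[n∸m]≡n a′≤a)))
      (solve 3 (λ a′ d b → a′ :+ d :+ con 0 :+ b := a′ :+ (b :+ d)) refl a′ d b)
      where open ℕ-Solver.+-*-Solver

  pPow-⊓ : ∀ a a′ b → pPow (a ℕ.⊓ a′) b ≤ pPow a b ⊔ pPow a′ b
  pPow-⊓ a a′ b with ℕ.≤-total a a′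
  ... | inj₁ a≤a′ = subst (_≤ pPow a b ⊔ pPow a′ b) (cong (λ x → pPow x b) (sym (ℕ.m≤n⇒m⊓n≡m a≤a′))) (ℚ.p≤p⊔q (pPow a b) (pPow a′ b))
  ... | inj₂ a′≤a = subst (_≤ pPow a b ⊔ pPow a′ b) (cong (λ x → pPow x b) (sym (ℕ.m≥n⇒m⊓n≡n a′≤a))) (ℚ.p≤q⊔p (pPow a b) (pPow a′ b))

  absFrac : ℕ → ℕ → ℚ
  absFrac zero      _ = 0ℚ
  absFrac n@(suc _) d = pPow (v n) (v d)

  absFrac-≢0 : ∀ {n d} → n ≢ 0 → absFrac n d ≡ pPow (v n) (v d)
  absFrac-≢0 {zero}  0≢0 = contradiction refl 0≢0
  absFrac-≢0 {suc n} _   = refl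

  absFrac-nonNeg : ∀ n d → 0ℚ ≤ absFrac n d
  absFrac-nonNeg zero    _ = ℚ.≤-refl
  absFrac-nonNeg (suc n) d = ℚ.<⇒≤ (pPow-pos (v (suc n)) (v d))

  absFrac-cong : ∀ {n d n′ d′} → n ℕ.* suc d′ ≡ n′ ℕ.* suc d → absFrac n (suc d) ≡ absFrac n′ (suc d′)
  absFrac-cong {zero}  {n′ = zero}  _  = refl
  absFrac-cong {suc n} {d} {suc n′} {d′} eq = pPow-cong {v (suc n)} {v (suc d)} {v (suc n′)} {v (suc d′)} (begin
    v (suc n) ℕ.+ v (suc d′)    ≡⟨ sym (v-* (suc n) (suc d′)) ⟩
    v (suc n ℕ.* suc d′)        ≡⟨ cong v eq ⟩
    v (suc n′ ℕ.* suc d)        ≡⟨ v-* (suc n′) (suc d) ⟩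
    v (suc n′) ℕ.+ v (suc d)    ∎)
    where open ≡-Reasoning

  absFrac-* : ∀ n d n′ d′ → absFrac (n ℕ.* n′) (suc d ℕ.* suc d′) ≡ absFrac n (suc d) * absFrac n′ (suc d′)
  absFrac-* zero    d n′      d′ = sym (ℚ.*-zeroˡ (absFrac n′ (suc d′)))
  absFrac-* (suc n) d zero    d′ =
    trans (cong (λ x → absFrac x (suc d ℕ.* suc d′)) (ℕ.*-zeroʳ n)) (sym (ℚ.*-zeroʳ (absFrac (suc n) (suc d))))
  absFrac-* (suc n) d (suc n′) d′ = begin
    pPow (v (suc n ℕ.* suc n′)) (v (suc d ℕ.* suc d′))   ≡⟨ cong₂ pPow (v-* (suc n) (suc n′)) (v-* (suc d) (suc d′)) ⟩
    pPow (v (suc n) ℕ.+ v (suc n′)) (v (suc d) ℕ.+ v (suc d′)) ≡⟨ sym (pPow-* (v (suc n)) (v (suc d)) (v (suc n′)) (v (suc d′))) ⟩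
    absFrac (suc n) (suc d) * absFrac (suc n′) (suc d′)  ∎
    where open ≡-Reasoning

  absFrac-+ : ∀ i j d → absFrac ℤ.∣ i ℤ.+ j ∣ d ≤ absFrac ℤ.∣ i ∣ d ⊔ absFrac ℤ.∣ j ∣ d
  absFrac-+ i j d with ℤ.∣ i ℤ.+ j ∣ in e+ | ℤ.∣ i ∣ in ei | ℤ.∣ j ∣ in ej
  ... | zero  | a     | b     = ℚ.≤-trans (absFrac-nonNeg a d) (ℚ.p≤p⊔q _ _)
  ... | suc m | zero  | b     = subst (λ x → absFrac x d ≤ 0ℚ ⊔ absFrac b d) (trans (sym ∣j∣≡) e+) (ℚ.p≤q⊔p 0ℚ _)
    where
    ∣j∣≡ : ℤ.∣ i ℤ.+ j ∣ ≡ b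
    ∣j∣≡ = trans (cong (λ x → ℤ.∣ x ℤ.+ j ∣) (ℤ.∣i∣≡0⇒i≡0 {i} ei)) (trans (cong ℤ.∣_∣ (ℤ.+-identityˡ j)) ej)
  ... | suc m | suc a | zero  = subst (λ x → absFrac x d ≤ absFrac (suc a) d ⊔ 0ℚ) (trans (sym ∣i∣≡) e+) (ℚ.p≤p⊔q _ 0ℚ)
    where
    ∣i∣≡ : ℤ.∣ i ℤ.+ j ∣ ≡ suc a
    ∣i∣≡ = trans (cong (λ x → ℤ.∣ i ℤ.+ x ∣) (ℤ.∣i∣≡0⇒i≡0 {j} ej)) (trans (cong ℤ.∣_∣ (ℤ.+-identityʳ i)) ei)
  ... | suc m | suc a | suc b = begin
    pPow (v (suc m)) (v d)                             ≤⟨ pPow-antitone (v d) min≤ ⟩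
    pPow (v (suc a) ℕ.⊓ v (suc b)) (v d)               ≤⟨ pPow-⊓ (v (suc a)) (v (suc b)) (v d) ⟩
    pPow (v (suc a)) (v d) ⊔ pPow (v (suc b)) (v d)    ∎
    where
    open ℚ.≤-Reasoning
    min≤ : v (suc a) ℕ.⊓ v (suc b) ℕ.≤ v (suc m)
    min≤ = subst₂ (λ x y → v x ℕ.⊓ v y ℕ.≤ v (suc m)) ei ej
             (subst (λ x → v ℤ.∣ i ∣ ℕ.⊓ v ℤ.∣ j ∣ ℕ.≤ v x) e+ (v-+ i j {{subst NonZero (sym e+) _}}))

  -- ∣_∣ₚ on unnormalised fractions: it respects ≃, so products and sums need no reduction.
  pabsᵘ : ℚᵘ.ℚᵘ → ℚ
  pabsᵘ x = absFrac ℤ.∣ ℚᵘ.↥ x ∣ (ℚᵘ.↧ₙ x)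

  pabsᵘ-cong : ∀ {x y} → x ℚᵘ.≃ y → pabsᵘ x ≡ pabsᵘ y
  pabsᵘ-cong {ℚᵘ.mkℚᵘ n d} {ℚᵘ.mkℚᵘ n′ d′} (ℚᵘ.*≡* eq) = absFrac-cong {ℤ.∣ n ∣} {d} {ℤ.∣ n′ ∣} {d′} (begin
    ℤ.∣ n ∣ ℕ.* suc d′         ≡⟨ sym (ℤ.abs-* n (+ suc d′)) ⟩
    ℤ.∣ n ℤ.* + suc d′ ∣       ≡⟨ cong ℤ.∣_∣ eq ⟩
    ℤ.∣ n′ ℤ.* + suc d ∣       ≡⟨ ℤ.abs-* n′ (+ suc d) ⟩
    ℤ.∣ n′ ∣ ℕ.* suc d         ∎)
    where open ≡-Reasoning

  pabsᵘ-* : ∀ x y → pabsᵘ (x ℚᵘ.* y) ≡ pabsᵘ x * pabsᵘ y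
  pabsᵘ-* (ℚᵘ.mkℚᵘ n d) (ℚᵘ.mkℚᵘ n′ d′) =
    trans (cong (λ m → absFrac m (suc d ℕ.* suc d′)) (ℤ.abs-* n n′)) (absFrac-* ℤ.∣ n ∣ d ℤ.∣ n′ ∣ d′)

  pabsᵘ-+ : ∀ x y → pabsᵘ (x ℚᵘ.+ y) ≤ pabsᵘ x ⊔ pabsᵘ y
  pabsᵘ-+ (ℚᵘ.mkℚᵘ n d) (ℚᵘ.mkℚᵘ n′ d′) = subst₂ (λ a b → absFrac ℤ.∣ i ℤ.+ j ∣ D ≤ a ⊔ b)
    (absFrac-cong {ℤ.∣ i ∣} {_} {ℤ.∣ n ∣} {d} eqˡ) (absFrac-cong {ℤ.∣ j ∣} {_} {ℤ.∣ n′ ∣} {d′} eqʳ)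
    (absFrac-+ i j D)
    where
    i = n ℤ.* + suc d′
    j = n′ ℤ.* + suc d
    D = suc d ℕ.* suc d′
    open ℕ-Solver.+-*-Solver
    eqˡ : ℤ.∣ n ℤ.* + suc d′ ∣ ℕ.* suc d ≡ ℤ.∣ n ∣ ℕ.* (suc d ℕ.* suc d′)
    eqˡ = trans (cong (ℕ._* suc d) (ℤ.abs-* n (+ suc d′)))
      (solve 3 (λ a b c → a :* c :* b := a :* (b :* c)) refl ℤ.∣ n ∣ (suc d) (suc d′))
    eqʳ : ℤ.∣ n′ ℤ.* + suc d ∣ ℕ.* suc d′ ≡ ℤ.∣ n′ ∣ ℕ.* (suc d ℕ.* suc d′)
    eqʳ = trans (cong (ℕ._* suc d′) (ℤ.abs-* n′ (+ suc d)))
      (solve 3 (λ a b c → a :* b :* c := a :* (b :* c)) refl ℤ.∣ n′ ∣ (suc d) (suc d′))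

  pabsᵘ-neg : ∀ x → pabsᵘ (ℚᵘ.- x) ≡ pabsᵘ x
  pabsᵘ-neg (ℚᵘ.mkℚᵘ n d) = cong (λ m → absFrac m (suc d)) (ℤ.∣-i∣≡∣i∣ n)

  private
    ∣↥∣≢0 : ∀ {x} → x ≢ 0ℚ → ℤ.∣ ↥ x ∣ ≢ 0
    ∣↥∣≢0 {x} x≢0 ∣↥x∣≡0 = x≢0 (ℚ.↥p≡0⇒p≡0 x (ℤ.∣i∣≡0⇒i≡0 ∣↥x∣≡0))

    pPow-from-+ : ∀ {a b n} → + n ≡ + a ℤ.- + b → pPow a b ≡ powℚ (pinv P) n
    pPow-from-+ {a} {b} {n} eq = trans (pPow-cong {a} {b} {n} {0} a+0≡n+b) (ℚ.*-identityʳ _)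
      where
      a+0≡n+b : a ℕ.+ 0 ≡ n ℕ.+ b
      a+0≡n+b = trans (ℕ.+-identityʳ a) (ℤ.+-injective (begin
        + a                  ≡⟨ solve 2 (λ a b → a := a :- b :+ b) refl (+ a) (+ b) ⟩
        + a ℤ.- + b ℤ.+ + b  ≡⟨ cong (ℤ._+ + b) (sym eq) ⟩
        + (n ℕ.+ b)          ∎))
        where
        open ≡-Reasoning
        open ℤ-Solver.+-*-Solver

    pPow-from-− : ∀ {a b n} → ℤ.-[1+ n ] ≡ + a ℤ.- + b → pPow a b ≡ powℚ (pℚ P) (suc n)
    pPow-from-− {a} {b} {n} eq = trans (pPow-cong {a} {b} {0} {suc n} a+n+1≡b) (ℚ.*-identityˡ _)
      where
      a+n+1≡b : a ℕ.+ suc n ≡ 0 ℕ.+ b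
      a+n+1≡b = ℤ.+-injective (begin
        + (a ℕ.+ suc n)          ≡⟨⟩
        + a ℤ.- ℤ.-[1+ n ]       ≡⟨ cong (λ z → + a ℤ.- z) eq ⟩
        + a ℤ.- (+ a ℤ.- + b)    ≡⟨ solve 2 (λ a b → a :- (a :- b) := b) refl (+ a) (+ b) ⟩
        + b                      ∎)
        where
        open ≡-Reasoning
        open ℤ-Solver.+-*-Solver

  pabs≡absFrac : ∀ x → pabs P x ≡ absFrac ℤ.∣ ↥ x ∣ (↧ₙ x)
  pabs≡absFrac x with x ℚ.≟ 0ℚ
  ... | yes refl = refl
  ... | no x≢0 with vp P x in eq
  ...   | + n        = sym (trans (absFrac-≢0 (∣↥∣≢0 x≢0)) (pPow-from-+ {v ℤ.∣ ↥ x ∣} {v (↧ₙ x)} (sym eq)))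
  ...   | ℤ.-[1+ n ] = sym (trans (absFrac-≢0 (∣↥∣≢0 x≢0)) (pPow-from-− {v ℤ.∣ ↥ x ∣} {v (↧ₙ x)} (sym eq)))

  pabs≡pabsᵘ : ∀ x → pabs P x ≡ pabsᵘ (toℚᵘ x)
  pabs≡pabsᵘ x@record{} = pabs≡absFrac x

  pabs-isNonArchimedeanAbsoluteValue : IsNonArchimedeanAbsoluteValue (pabs P)
  pabs-isNonArchimedeanAbsoluteValue = record
    { ∣0∣≡0         = refl
    ; x≢0⇒0<∣x∣     = λ {x} x≢0 → subst (0ℚ <_) (sym (trans (pabs≡absFrac x) (absFrac-≢0 (∣↥∣≢0 x≢0)))) (pPow-pos (v ℤ.∣ ↥ x ∣) (v (↧ₙ x)))
    ; ∣1∣≡1         = trans (pabs≡absFrac 1ℚ) (cong₂ pPow v1≡0 v1≡0)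
    ; ∣-x∣≡∣x∣      = λ x → trans (via (ℚ.toℚᵘ-homo‿- x)) (trans (pabsᵘ-neg (toℚᵘ x)) (sym (pabs≡pabsᵘ x)))
    ; ∣x*y∣≡∣x∣*∣y∣ = λ x y → trans (via (ℚ.toℚᵘ-homo-* x y))
                                 (trans (pabsᵘ-* (toℚᵘ x) (toℚᵘ y)) (sym (cong₂ _*_ (pabs≡pabsᵘ x) (pabs≡pabsᵘ y))))
    ; ∣x+y∣≤∣x∣⊔∣y∣ = λ x y → subst₂ _≤_ (sym (via (ℚ.toℚᵘ-homo-+ x y))) (sym (cong₂ _⊔_ (pabs≡pabsᵘ x) (pabs≡pabsᵘ y)))
                                       (pabsᵘ-+ (toℚᵘ x) (toℚᵘ y))
    }
    where
    v1≡0 : v 1 ≡ 0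
    v1≡0 = v-P^e*u 0 {1} (λ P∣1 → contradiction (ℕ.∣1⇒≡1 P∣1) (λ ()))
    via : ∀ {x u} → toℚᵘ x ℚᵘ.≃ u → pabs P x ≡ pabsᵘ u
    via {x} x≃u = trans (pabs≡pabsᵘ x) (pabsᵘ-cong x≃u)

-- 2 × 2 matrices and continued fractions

open import Data.List using (List; []; _∷_; _++_; _∷ʳ_; map; upTo)
import Data.List.Properties as List

mat-cong : ∀ {a b c d a′ b′ c′ d′} → a ≡ a′ → b ≡ b′ → c ≡ c′ → d ≡ d′ → mat a b c d ≡ mat a′ b′ c′ d′
mat-cong refl refl refl refl = refl

det : Mat → ℚ
det (mat a b c d) = a * d - b * c

tr : Mat → ℚ
tr (mat a b c d) = a + d

_·ᴹ_ : ℚ → Mat → Mat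
t ·ᴹ mat a b c d = mat (t * a) (t * b) (t * c) (t * d)

_-ᴹ_ : Mat → Mat → Mat
mat a b c d -ᴹ mat a′ b′ c′ d′ = mat (a - a′) (b - b′) (c - c′) (d - d′)

⊗-assoc : ∀ X Y Z → (X ⊗ Y) ⊗ Z ≡ X ⊗ (Y ⊗ Z)
⊗-assoc (mat a b c d) (mat e f g h) (mat i j k l) = mat-cong (entry a b e f g h i k) (entry a b e f g h j l) (entry c d e f g h i k) (entry c d e f g h j l)
  where
  open ℚ-Solver.+-*-Solver
  entry : ∀ a b e f g h i k → (a * e + b * g) * i + (a * f + b * h) * k ≡ a * (e * i + f * k) + b * (g * i + h * k)
  entry = solve 8 (λ a b e f g h i k → (a :* e :+ b :* g) :* i :+ (a :* f :+ b :* h) :* k := a :* (e :* i :+ f :* k) :+ b :* (g :* i :+ h :* k)) refl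

⊗-identityʳ : ∀ X → X ⊗ Id₂ ≡ X
⊗-identityʳ (mat a b c d) = mat-cong (first a b) (second a b) (first c d) (second c d)
  where
  open ℚ-Solver.+-*-Solver
  first : ∀ a b → a * 1ℚ + b * 0ℚ ≡ a
  first = solve 2 (λ a b → a :* con 1ℚ :+ b :* con 0ℚ := a) refl
  second : ∀ a b → a * 0ℚ + b * 1ℚ ≡ b
  second = solve 2 (λ a b → a :* con 0ℚ :+ b :* con 1ℚ := b) refl

det-⊗ : ∀ X Y → det (X ⊗ Y) ≡ det X * det Y
det-⊗ (mat a b c d) (mat e f g h) = solve 8 (λ a b c d e f g h →
  (a :* e :+ b :* g) :* (c :* f :+ d :* h) :- (a :* f :+ b :* h) :* (c :* e :+ d :* g) := (a :* d :- b :* c) :* (e :* h :- f :* g)) refl a b c d e f g h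
  where open ℚ-Solver.+-*-Solver

cayley-hamilton : ∀ X Y → X ⊗ (X ⊗ Y) ≡ (tr X ·ᴹ (X ⊗ Y)) -ᴹ (det X ·ᴹ Y)
cayley-hamilton (mat a b c d) (mat e f g h) = mat-cong (top a b c d e g) (top a b c d f h) (bottom a b c d e g) (bottom a b c d f h)
  where
  open ℚ-Solver.+-*-Solver
  top : ∀ a b c d e g → a * (a * e + b * g) + b * (c * e + d * g) ≡ (a + d) * (a * e + b * g) - (a * d - b * c) * e
  top = solve 6 (λ a b c d e g → a :* (a :* e :+ b :* g) :+ b :* (c :* e :+ d :* g) := (a :+ d) :* (a :* e :+ b :* g) :- (a :* d :- b :* c) :* e) refl
  bottom : ∀ a b c d e g → c * (a * e + b * g) + d * (c * e + d * g) ≡ (a + d) * (c * e + d * g) - (a * d - b * c) * g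
  bottom = solve 6 (λ a b c d e g → c :* (a :* e :+ b :* g) :+ d :* (c :* e :+ d :* g) := (a :+ d) :* (c :* e :+ d :* g) :- (a :* d :- b :* c) :* g) refl

⊗-identityˡ : ∀ X → Id₂ ⊗ X ≡ X
⊗-identityˡ (mat a b c d) = mat-cong (first a c) (first b d) (second a c) (second b d)
  where
  open ℚ-Solver.+-*-Solver
  first : ∀ a c → 1ℚ * a + 0ℚ * c ≡ a
  first = solve 2 (λ a c → con 1ℚ :* a :+ con 0ℚ :* c := a) refl
  second : ∀ a c → 0ℚ * a + 1ℚ * c ≡ c
  second = solve 2 (λ a c → con 0ℚ :* a :+ con 1ℚ :* c := c) refl

M-++ : ∀ xs ys → M (xs ++ ys) ≡ M xs ⊗ M ys
M-++ []       ys = sym (⊗-identityˡ (M ys))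
M-++ (x ∷ xs) ys = trans (cong (mat x 1ℚ 1ℚ 0ℚ ⊗_) (M-++ xs ys)) (sym (⊗-assoc (mat x 1ℚ 1ℚ 0ℚ) (M xs) (M ys)))

det-M-∷ : ∀ x xs → det (M (x ∷ xs)) ≡ - det (M xs)
det-M-∷ x xs = trans (det-⊗ (mat x 1ℚ 1ℚ 0ℚ) (M xs))
  (solve 2 (λ x D → (x :* con 0ℚ :- con 1ℚ :* con 1ℚ) :* D := :- D) refl x (det (M xs)))
  where open ℚ-Solver.+-*-Solver

Point : Set
Point = ℚ × ℚ

cross : Point → Point → ℚ
cross (a , b) (a′ , b′) = a * b′ - a′ * b

column₁ column₂ : Mat → Point
column₁ X = e11 X , e21 X
column₂ X = e12 X , e22 X

cross-self : ∀ x → cross x x ≡ 0ℚ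
cross-self (a , b) = ℚ.+-inverseʳ (a * b)

cross-columns : ∀ X → cross (column₂ X) (column₁ X) ≡ - det X
cross-columns (mat a b c d) = solve 4 (λ a b c d → b :* c :- a :* d := :- (a :* d :- b :* c)) refl a b c d
  where open ℚ-Solver.+-*-Solver

cross-column₁-⊗ : ∀ X W → cross (column₁ X) (column₁ (X ⊗ W)) ≡ e21 W * det X
cross-column₁-⊗ (mat a b c d) (mat α β γ δ) = solve 6 (λ a b c d α γ →
  a :* (c :* α :+ d :* γ) :- (a :* α :+ b :* γ) :* c := γ :* (a :* d :- b :* c)) refl a b c d α γ
  where open ℚ-Solver.+-*-Solver

column₁-⊗-upper : ∀ X W → e21 W ≡ 0ℚ → column₁ (X ⊗ W) ≡ (e11 X * e11 W , e21 X * e11 W)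
column₁-⊗-upper (mat a b c d) (mat α β .0ℚ δ) refl = cong₂ _,_ (lemma a b) (lemma c d)
  where
  lemma : ∀ a b → a * α + b * 0ℚ ≡ a * α
  lemma a b = solve 3 (λ a b α → a :* α :+ b :* con 0ℚ := a :* α) refl a b α
    where open ℚ-Solver.+-*-Solver

det-upper : ∀ W → e21 W ≡ 0ℚ → det W ≡ e11 W * e22 W
det-upper (mat α β .0ℚ δ) refl = solve 3 (λ α β δ → α :* δ :- β :* con 0ℚ := α :* δ) refl α β δ
  where open ℚ-Solver.+-*-Solver

LinearRecurrence : ℚ → ℚ → (ℕ → ℚ) → Set
LinearRecurrence t d z = ∀ n → z (suc (suc n)) ≡ t * z (suc n) - d * z n

recurrence-cross : ∀ {t d} u (v : ℕ → Point) → LinearRecurrence t d (λ n → proj₁ (v n)) → LinearRecurrence t d (λ n → proj₂ (v n)) →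
                   LinearRecurrence t d (λ n → cross u (v n))
recurrence-cross {t} {d} (a , b) v rec₁ rec₂ n = trans (cong₂ (λ x y → a * y - x * b) (rec₁ n) (rec₂ n))
  (solve 8 (λ t d a b x₁ x₀ y₁ y₀ → a :* (t :* y₁ :- d :* y₀) :- (t :* x₁ :- d :* x₀) :* b
                                   := t :* (a :* y₁ :- x₁ :* b) :- d :* (a :* y₀ :- x₀ :* b)) refl
    t d a b (proj₁ (v (suc n))) (proj₁ (v n)) (proj₂ (v (suc n))) (proj₂ (v n)))
  where open ℚ-Solver.+-*-Solver

module ContinuedFraction (c : ℕ → ℚ) where

  segment : ℕ → ℕ → List ℚ
  segment j r = map (λ i → c (j ℕ.+ i)) (upTo r)

  convergent : ℕ → Point
  convergent n = A c n , B c n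

  convergentMatrix : ℕ → Mat
  convergentMatrix n = M (segment 1 n)

  M-segment-suc : ∀ j r → M (segment j (suc r)) ≡ M (segment j r) ⊗ mat (c (j ℕ.+ r)) 1ℚ 1ℚ 0ℚ
  M-segment-suc j r = begin
    M (segment j (suc r))                          ≡⟨ cong (λ is → M (map f is)) (sym (List.upTo-∷ʳ r)) ⟩
    M (map f (upTo r ∷ʳ r))                        ≡⟨ cong M (List.map-++ f (upTo r) (r ∷ [])) ⟩
    M (segment j r ∷ʳ f r)                         ≡⟨ M-++ (segment j r) (f r ∷ []) ⟩
    M (segment j r) ⊗ (mat (f r) 1ℚ 1ℚ 0ℚ ⊗ Id₂)   ≡⟨ cong (M (segment j r) ⊗_) (⊗-identityʳ (mat (f r) 1ℚ 1ℚ 0ℚ)) ⟩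
    M (segment j r) ⊗ mat (f r) 1ℚ 1ℚ 0ℚ           ∎
    where
    open ≡-Reasoning
    f = λ i → c (j ℕ.+ i)

  M-segment-+ : ∀ j r s → M (segment j (r ℕ.+ s)) ≡ M (segment j r) ⊗ M (segment (j ℕ.+ r) s)
  M-segment-+ j r zero    = trans (cong (λ n → M (segment j n)) (ℕ.+-identityʳ r)) (sym (⊗-identityʳ (M (segment j r))))
  M-segment-+ j r (suc s) = begin
    X (r ℕ.+ suc s)                                ≡⟨ cong X (ℕ.+-suc r s) ⟩
    X (suc (r ℕ.+ s))                              ≡⟨ M-segment-suc j (r ℕ.+ s) ⟩
    X (r ℕ.+ s) ⊗ E (c (j ℕ.+ (r ℕ.+ s)))          ≡⟨ cong₂ _⊗_ (M-segment-+ j r s) (cong (λ n → E (c n)) (sym (ℕ.+-assoc j r s))) ⟩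
    (X r ⊗ Y s) ⊗ E (c (j ℕ.+ r ℕ.+ s))            ≡⟨ ⊗-assoc (X r) (Y s) (E (c (j ℕ.+ r ℕ.+ s))) ⟩
    X r ⊗ (Y s ⊗ E (c (j ℕ.+ r ℕ.+ s)))            ≡⟨ cong (X r ⊗_) (sym (M-segment-suc (j ℕ.+ r) s)) ⟩
    X r ⊗ Y (suc s)                                ∎
    where
    open ≡-Reasoning
    E = λ x → mat x 1ℚ 1ℚ 0ℚ
    X = λ n → M (segment j n)
    Y = λ n → M (segment (j ℕ.+ r) n)

  convergentMatrix-suc : ∀ n → convergentMatrix (suc n) ≡ mat (A c (suc n)) (A c n) (B c (suc n)) (B c n)
  convergentMatrix-suc zero = trans (M-segment-suc 1 0) (⊗-identityˡ (mat (c 1) 1ℚ 1ℚ 0ℚ))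
  convergentMatrix-suc (suc n) = begin
    convergentMatrix (suc (suc n))                                               ≡⟨ M-segment-suc 1 (suc n) ⟩
    convergentMatrix (suc n) ⊗ mat x 1ℚ 1ℚ 0ℚ                                    ≡⟨ cong (_⊗ mat x 1ℚ 1ℚ 0ℚ) (convergentMatrix-suc n) ⟩
    mat (A c (suc n)) (A c n) (B c (suc n)) (B c n) ⊗ mat x 1ℚ 1ℚ 0ℚ             ≡⟨ mat-cong (first a₁ a₀) (second a₁ a₀) (first b₁ b₀) (second b₁ b₀) ⟩
    mat (A c (suc (suc n))) (A c (suc n)) (B c (suc (suc n))) (B c (suc n))      ∎
    where
    open ≡-Reasoning
    open ℚ-Solver.+-*-Solver
    x = c (suc (suc n))
    a₁ = A c (suc n)
    a₀ = A c n
    b₁ = B c (suc n)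
    b₀ = B c n
    first : ∀ a b → a * x + b * 1ℚ ≡ a * x + b
    first a b = solve 3 (λ a b x → a :* x :+ b :* con 1ℚ := a :* x :+ b) refl a b x
    second : ∀ a b → a * 1ℚ + b * 0ℚ ≡ a
    second = solve 2 (λ a b → a :* con 1ℚ :+ b :* con 0ℚ := a) refl

  column₁-convergentMatrix : ∀ n → column₁ (convergentMatrix n) ≡ convergent n
  column₁-convergentMatrix zero    = refl
  column₁-convergentMatrix (suc n) = cong column₁ (convergentMatrix-suc n)

  column₂-convergentMatrix : ∀ n → column₂ (convergentMatrix (suc n)) ≡ convergent n
  column₂-convergentMatrix n = cong column₂ (convergentMatrix-suc n)

module PeriodicContinuedFraction (c : ℕ → ℚ) (k : ℕ) (c-periodic : ∀ n → c (suc n ℕ.+ k) ≡ c (suc n)) where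
  open ContinuedFraction c

  segment-shift : ∀ j r → segment (suc j ℕ.+ k) r ≡ segment (suc j) r
  segment-shift j r = List.map-cong c-shift (upTo r)
    where
    open ℕ-Solver.+-*-Solver
    c-shift : ∀ i → c (suc j ℕ.+ k ℕ.+ i) ≡ c (suc j ℕ.+ i)
    c-shift i = trans (cong c (solve 3 (λ j k i → con 1 :+ j :+ k :+ i := con 1 :+ (j :+ i) :+ k) refl j k i)) (c-periodic (j ℕ.+ i))

  segment-periodic : ∀ n j r → segment (suc j ℕ.+ n ℕ.* k) r ≡ segment (suc j) r
  segment-periodic zero    j r = cong (λ i → segment i r) (ℕ.+-identityʳ (suc j))
  segment-periodic (suc n) j r = begin
    segment (suc j ℕ.+ (k ℕ.+ n ℕ.* k)) r   ≡⟨ cong (λ i → segment i r) (solve 3 (λ j k m → con 1 :+ j :+ (k :+ m) := con 1 :+ (j :+ m) :+ k) refl j k (n ℕ.* k)) ⟩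
    segment (suc (j ℕ.+ n ℕ.* k) ℕ.+ k) r   ≡⟨ segment-shift (j ℕ.+ n ℕ.* k) r ⟩
    segment (suc j ℕ.+ n ℕ.* k) r           ≡⟨ segment-periodic n j r ⟩
    segment (suc j) r                       ∎
    where
    open ≡-Reasoning
    open ℕ-Solver.+-*-Solver

  monodromy : Mat
  monodromy = convergentMatrix k

  windowMatrix : ℕ → Mat
  windowMatrix r = M (segment (suc r) k)

  residue : ℕ → ℕ → Mat
  residue r n = convergentMatrix (n ℕ.* k ℕ.+ r)

  residue-suc-right : ∀ r n → residue r (suc n) ≡ residue r n ⊗ windowMatrix r
  residue-suc-right r n = begin
    convergentMatrix (k ℕ.+ n ℕ.* k ℕ.+ r)                        ≡⟨ cong convergentMatrix (solve 3 (λ k m r → k :+ m :+ r := m :+ r :+ k) refl k (n ℕ.* k) r) ⟩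
    convergentMatrix (n ℕ.* k ℕ.+ r ℕ.+ k)                        ≡⟨ M-segment-+ 1 (n ℕ.* k ℕ.+ r) k ⟩
    residue r n ⊗ M (segment (suc (n ℕ.* k ℕ.+ r)) k)             ≡⟨ cong (λ i → residue r n ⊗ M (segment (suc i) k)) (ℕ.+-comm (n ℕ.* k) r) ⟩
    residue r n ⊗ M (segment (suc r ℕ.+ n ℕ.* k) k)               ≡⟨ cong (λ s → residue r n ⊗ M s) (segment-periodic n r k) ⟩
    residue r n ⊗ windowMatrix r                                  ∎
    where
    open ≡-Reasoning
    open ℕ-Solver.+-*-Solver

  residue-suc-left : ∀ r n → residue r (suc n) ≡ monodromy ⊗ residue r n
  residue-suc-left r n = begin
    convergentMatrix (k ℕ.+ n ℕ.* k ℕ.+ r)                        ≡⟨ cong convergentMatrix (ℕ.+-assoc k (n ℕ.* k) r) ⟩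
    convergentMatrix (k ℕ.+ (n ℕ.* k ℕ.+ r))                      ≡⟨ M-segment-+ 1 k (n ℕ.* k ℕ.+ r) ⟩
    monodromy ⊗ M (segment (suc k) (n ℕ.* k ℕ.+ r))               ≡⟨ cong (λ s → monodromy ⊗ M s) (segment-shift 0 (n ℕ.* k ℕ.+ r)) ⟩
    monodromy ⊗ residue r n                                       ∎
    where open ≡-Reasoning

  residue-recurrence : ∀ r n → residue r (suc (suc n)) ≡ (tr monodromy ·ᴹ residue r (suc n)) -ᴹ (det monodromy ·ᴹ residue r n)
  residue-recurrence r n = begin
    residue r (suc (suc n))                              ≡⟨ residue-suc-left r (suc n) ⟩
    monodromy ⊗ residue r (suc n)                        ≡⟨ cong (monodromy ⊗_) (residue-suc-left r n) ⟩
    monodromy ⊗ (monodromy ⊗ residue r n)                ≡⟨ cayley-hamilton monodromy (residue r n) ⟩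
    (tr monodromy ·ᴹ (monodromy ⊗ residue r n)) -ᴹ (det monodromy ·ᴹ residue r n)
                                                         ≡⟨ cong (λ X → (tr monodromy ·ᴹ X) -ᴹ (det monodromy ·ᴹ residue r n)) (sym (residue-suc-left r n)) ⟩
    (tr monodromy ·ᴹ residue r (suc n)) -ᴹ (det monodromy ·ᴹ residue r n) ∎
    where open ≡-Reasoning

-- Estimates for a non-archimedean absolute value

module NonArchimedean {∣_∣ : ℚ → ℚ} (isAbs : IsNonArchimedeanAbsoluteValue ∣_∣) where
  open IsNonArchimedeanAbsoluteValue isAbs

  0≤∣x∣ : ∀ x → 0ℚ ≤ ∣ x ∣
  0≤∣x∣ x with x ℚ.≟ 0ℚ
  ... | yes refl = ℚ.≤-reflexive (sym ∣0∣≡0)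
  ... | no  x≢0  = ℚ.<⇒≤ (x≢0⇒0<∣x∣ x≢0)

  ∣x-y∣≤∣x∣⊔∣y∣ : ∀ x y → ∣ x - y ∣ ≤ ∣ x ∣ ⊔ ∣ y ∣
  ∣x-y∣≤∣x∣⊔∣y∣ x y = subst (λ a → ∣ x - y ∣ ≤ ∣ x ∣ ⊔ a) (∣-x∣≡∣x∣ y) (∣x+y∣≤∣x∣⊔∣y∣ x (- y))

  ∣x-y∣≡∣x∣ : ∀ {x y} → ∣ y ∣ < ∣ x ∣ → ∣ x - y ∣ ≡ ∣ x ∣
  ∣x-y∣≡∣x∣ {x} {y} ∣y∣<∣x∣ = ℚ.≤-antisym
    (ℚ.≤-trans (∣x-y∣≤∣x∣⊔∣y∣ x y) (ℚ.≤-reflexive (ℚ.p≥q⇒p⊔q≡p (ℚ.<⇒≤ ∣y∣<∣x∣))))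
    ∣x∣≤∣x-y∣
    where
    ∣x∣≤∣x-y∣⊔∣y∣ : ∣ x ∣ ≤ ∣ x - y ∣ ⊔ ∣ y ∣
    ∣x∣≤∣x-y∣⊔∣y∣ = subst (λ a → ∣ a ∣ ≤ ∣ x - y ∣ ⊔ ∣ y ∣) (solve 2 (λ x y → x :- y :+ y := x) refl x y)
      (∣x+y∣≤∣x∣⊔∣y∣ (x - y) y)
      where open ℚ-Solver.+-*-Solver
    ∣x∣≤∣x-y∣ : ∣ x ∣ ≤ ∣ x - y ∣
    ∣x∣≤∣x-y∣ with ℚ.⊔-sel ∣ x - y ∣ ∣ y ∣
    ... | inj₁ ⊔≡ = subst (∣ x ∣ ≤_) ⊔≡ ∣x∣≤∣x-y∣⊔∣y∣
    ... | inj₂ ⊔≡ = contradiction (subst (∣ x ∣ ≤_) ⊔≡ ∣x∣≤∣x-y∣⊔∣y∣) (<⇒≱ ∣y∣<∣x∣)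

  height : Point → ℚ
  height (a , b) = ∣ a ∣ ⊔ ∣ b ∣

  0≤height : ∀ x → 0ℚ ≤ height x
  0≤height (a , b) = ℚ.≤-trans (0≤∣x∣ a) (ℚ.p≤p⊔q ∣ a ∣ ∣ b ∣)

  ∣x*y∣≤ : ∀ {x y X Y} → ∣ x ∣ ≤ X → ∣ y ∣ ≤ Y → ∣ x * y ∣ ≤ X * Y
  ∣x*y∣≤ {x} {y} {X} {Y} ∣x∣≤X ∣y∣≤Y = subst (_≤ X * Y) (sym (∣x*y∣≡∣x∣*∣y∣ x y)) (*-mono-≤-nonNeg (0≤∣x∣ x) (0≤∣x∣ y) ∣x∣≤X ∣y∣≤Y)

  ∣xy+zw∣≤ : ∀ {x y z w X Y Z W} → ∣ x ∣ ≤ X → ∣ y ∣ ≤ Y → ∣ z ∣ ≤ Z → ∣ w ∣ ≤ W → ∣ x * y + z * w ∣ ≤ (X * Y) ⊔ (Z * W)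
  ∣xy+zw∣≤ {x} {y} {z} {w} ∣x∣≤X ∣y∣≤Y ∣z∣≤Z ∣w∣≤W =
    ℚ.≤-trans (∣x+y∣≤∣x∣⊔∣y∣ (x * y) (z * w)) (ℚ.⊔-mono-≤ (∣x*y∣≤ ∣x∣≤X ∣y∣≤Y) (∣x*y∣≤ ∣z∣≤Z ∣w∣≤W))

  ∣cross∣≤height*height : ∀ x y → ∣ cross x y ∣ ≤ height x * height y
  ∣cross∣≤height*height (a , b) (a′ , b′) = ℚ.≤-trans (∣x-y∣≤∣x∣⊔∣y∣ (a * b′) (a′ * b)) (ℚ.⊔-lub
    (∣x*y∣≤ (ℚ.p≤p⊔q (∣ a ∣) (∣ b ∣)) (ℚ.p≤q⊔p (∣ a′ ∣) (∣ b′ ∣)))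
    (subst (∣ a′ * b ∣ ≤_) (ℚ.*-comm (height (a′ , b′)) (height (a , b)))
      (∣x*y∣≤ (ℚ.p≤p⊔q (∣ a′ ∣) (∣ b′ ∣)) (ℚ.p≤q⊔p (∣ a ∣) (∣ b ∣)))))

  cross-ultrametric : ∀ x y z → ∣ cross x z ∣ * height y ≤ (∣ cross x y ∣ * height z) ⊔ (∣ cross y z ∣ * height x)
  cross-ultrametric x@(a , b) y@(e , f) z@(g , h) = begin
    ∣ cross x z ∣ * (∣ e ∣ ⊔ ∣ f ∣)                      ≡⟨ ℚ.*-distribˡ-⊔-nonNeg (∣ cross x z ∣) {{ℚ.nonNegative (0≤∣x∣ (cross x z))}} (∣ e ∣) (∣ f ∣) ⟩
    (∣ cross x z ∣ * ∣ e ∣) ⊔ (∣ cross x z ∣ * ∣ f ∣)     ≡⟨ sym (cong₂ _⊔_ (∣x*y∣≡∣x∣*∣y∣ (cross x z) e) (∣x*y∣≡∣x∣*∣y∣ (cross x z) f)) ⟩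
    (∣ cross x z * e ∣) ⊔ (∣ cross x z * f ∣)             ≡⟨ cong₂ (λ u w → (∣ u ∣) ⊔ (∣ w ∣)) (plücker₁ a b e f g h) (plücker₂ a b e f g h) ⟩
    (∣ cross x y * g + cross y z * a ∣) ⊔ (∣ cross x y * h + cross y z * b ∣)
      ≤⟨ ℚ.⊔-lub (∣xy+zw∣≤ ℚ.≤-refl (ℚ.p≤p⊔q (∣ g ∣) (∣ h ∣)) ℚ.≤-refl (ℚ.p≤p⊔q (∣ a ∣) (∣ b ∣)))
                 (∣xy+zw∣≤ ℚ.≤-refl (ℚ.p≤q⊔p (∣ g ∣) (∣ h ∣)) ℚ.≤-refl (ℚ.p≤q⊔p (∣ a ∣) (∣ b ∣))) ⟩
    (∣ cross x y ∣ * height z) ⊔ (∣ cross y z ∣ * height x) ∎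
    where
    open ℚ.≤-Reasoning
    open ℚ-Solver.+-*-Solver
    plücker₁ : ∀ a b e f g h → (a * h - g * b) * e ≡ (a * f - e * b) * g + (e * h - g * f) * a
    plücker₁ = solve 6 (λ a b e f g h → (a :* h :- g :* b) :* e := (a :* f :- e :* b) :* g :+ (e :* h :- g :* f) :* a) refl
    plücker₂ : ∀ a b e f g h → (a * h - g * b) * f ≡ (a * f - e * b) * h + (e * h - g * f) * b
    plücker₂ = solve 6 (λ a b e f g h → (a :* h :- g :* b) :* f := (a :* f :- e :* b) :* h :+ (e :* h :- g :* f) :* b) refl

  Close : ℚ → Point → Point → Set
  Close ε x y = ∣ cross x y ∣ ≤ ε * (height x * height y)

  close-refl : ∀ {ε} → 0ℚ ≤ ε → ∀ x → Close ε x x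
  close-refl {ε} 0≤ε x = subst (_≤ ε * (height x * height x)) (sym (trans (cong ∣_∣ (cross-self x)) ∣0∣≡0))
    (*-nonNeg 0≤ε (*-nonNeg (0≤height x) (0≤height x)))

  close-sym : ∀ {ε} x y → Close ε x y → Close ε y x
  close-sym {ε} x@(a , b) y@(a′ , b′) = subst₂ _≤_ ∣cross∣-swap (cong (ε *_) (ℚ.*-comm (height x) (height y)))
    where
    ∣cross∣-swap : ∣ cross x y ∣ ≡ ∣ cross y x ∣
    ∣cross∣-swap = trans (cong ∣_∣ (solve 4 (λ a b a′ b′ → a :* b′ :- a′ :* b := :- (a′ :* b :- a :* b′)) refl a b a′ b′))
                         (∣-x∣≡∣x∣ (cross y x))
      where open ℚ-Solver.+-*-Solver

  close-trans : ∀ {ε} x y z → 0ℚ < height y → Close ε x y → Close ε y z → Close ε x z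
  close-trans {ε} x y z 0<hy xy yz = ℚ.*-cancelʳ-≤-pos (height y) {{ℚ.positive 0<hy}} (begin
    ∣ cross x z ∣ * hy                                       ≤⟨ cross-ultrametric x y z ⟩
    (∣ cross x y ∣ * hz) ⊔ (∣ cross y z ∣ * hx)              ≤⟨ ℚ.⊔-mono-≤ (ℚ.*-monoʳ-≤-nonNeg hz {{ℚ.nonNegative (0≤height z)}} xy)
                                                                           (ℚ.*-monoʳ-≤-nonNeg hx {{ℚ.nonNegative (0≤height x)}} yz) ⟩
    (ε * (hx * hy) * hz) ⊔ (ε * (hy * hz) * hx)              ≡⟨ cong₂ _⊔_ (solve 4 (λ ε a b c → ε :* (a :* b) :* c := ε :* (a :* c) :* b) refl ε hx hy hz)
                                                                            (solve 4 (λ ε a b c → ε :* (b :* c) :* a := ε :* (a :* c) :* b) refl ε hx hy hz) ⟩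
    (ε * (hx * hz) * hy) ⊔ (ε * (hx * hz) * hy)              ≡⟨ ℚ.⊔-idem _ ⟩
    ε * (hx * hz) * hy                                       ∎)
    where
    open ℚ.≤-Reasoning
    open ℚ-Solver.+-*-Solver
    hx = height x
    hy = height y
    hz = height z

  Convergent : (ℕ → Point) → Set
  Convergent x = ∀ ε → 0ℚ < ε → ∃[ N ] ∀ m n → N ℕ.≤ m → N ℕ.≤ n → Close ε (x m) (x n)

  convergent-if-consecutive : ∀ {x} → (∀ n → 0ℚ < height (x n)) →
                              (∀ ε → 0ℚ < ε → Eventually (λ n → Close ε (x n) (x (suc n)))) → Convergent x
  convergent-if-consecutive {x} 0<h consecutive ε 0<ε = N , close
    where
    N = proj₁ (consecutive ε 0<ε)
    step : ∀ n → N ℕ.≤ n → Close ε (x n) (x (suc n))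
    step = proj₂ (consecutive ε 0<ε)
    far : ∀ d m → N ℕ.≤ m → Close ε (x m) (x (d ℕ.+ m))
    far zero    m _   = close-refl (ℚ.<⇒≤ 0<ε) (x m)
    far (suc d) m N≤m = close-trans {ε} (x m) (x (d ℕ.+ m)) (x (suc d ℕ.+ m)) (0<h (d ℕ.+ m))
      (far d m N≤m) (step (d ℕ.+ m) (ℕ.≤-trans N≤m (ℕ.m≤n+m m d)))
    close : ∀ m n → N ℕ.≤ m → N ℕ.≤ n → Close ε (x m) (x n)
    close m n N≤m N≤n with ℕ.≤-total m n
    ... | inj₁ m≤n = subst (λ i → Close ε (x m) (x i)) (ℕ.m∸n+n≡m m≤n) (far (n ℕ.∸ m) m N≤m)
    ... | inj₂ n≤m = close-sym {ε} (x n) (x m) (subst (λ i → Close ε (x n) (x i)) (ℕ.m∸n+n≡m n≤m) (far (m ℕ.∸ n) n N≤n))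

  convergent⇔consecutiveHeights→∞ : ∀ {x} → (∀ n → ∣ cross (x n) (x (suc n)) ∣ ≡ 1ℚ) →
                                Convergent x ⇔ TendsToInfinity (λ n → height (x n) * height (x (suc n)))
  convergent⇔consecutiveHeights→∞ {x} ∣cross∣≡1 = mk⇔ to from
    where
    G : ℕ → ℚ
    G n = height (x n) * height (x (suc n))
    1≤G : ∀ n → 1ℚ ≤ G n
    1≤G n = subst (_≤ G n) (∣cross∣≡1 n) (∣cross∣≤height*height (x n) (x (suc n)))
    to : Convergent x → TendsToInfinity G
    to conv B = N , λ n N≤n → ℚ.≤-trans (ℚ.p≤q⊔p 1ℚ B) (begin
      B′                     ≡⟨ sym (ℚ.*-identityʳ B′) ⟩
      B′ * 1ℚ                ≤⟨ ℚ.*-monoˡ-≤-nonNeg B′ {{ℚ.nonNegative (ℚ.<⇒≤ 0<B′)}} (subst (_≤ ε * G n) (∣cross∣≡1 n) (close n (suc n) N≤n (ℕ.m≤n⇒m≤1+n N≤n))) ⟩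
      B′ * (ε * G n)         ≡⟨ sym (ℚ.*-assoc B′ ε (G n)) ⟩
      B′ * ε * G n           ≡⟨ cong (_* G n) (ℚ.*-inverseʳ B′) ⟩
      1ℚ * G n               ≡⟨ ℚ.*-identityˡ (G n) ⟩
      G n                    ∎)
      where
      open ℚ.≤-Reasoning
      B′ = 1ℚ ⊔ B
      0<B′ : 0ℚ < B′
      0<B′ = ℚ.<-≤-trans 0<1 (ℚ.p≤p⊔q 1ℚ B)
      instance
        B′≢0 : ℚ.NonZero B′
        B′≢0 = ℚ.pos⇒nonZero B′ {{ℚ.positive 0<B′}}
      ε = ℚ.1/ B′
      N = proj₁ (conv ε (ℚ.positive⁻¹ ε {{ℚ.1/pos⇒pos B′ {{ℚ.positive 0<B′}}}}))
      close : ∀ m n → N ℕ.≤ m → N ℕ.≤ n → Close ε (x m) (x n)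
      close = proj₂ (conv ε (ℚ.positive⁻¹ ε {{ℚ.1/pos⇒pos B′ {{ℚ.positive 0<B′}}}}))
    from : TendsToInfinity G → Convergent x
    from G→∞ = convergent-if-consecutive (λ n → 1≤a*b⇒0<a (0≤height (x (suc n))) (1≤G n)) consecutive
      where
      consecutive : ∀ ε → 0ℚ < ε → Eventually (λ n → Close ε (x n) (x (suc n)))
      consecutive ε 0<ε = eventually-map (λ {n} 1/ε≤G → subst (_≤ ε * G n) (trans (ℚ.*-inverseʳ ε) (sym (∣cross∣≡1 n)))
                                                         (ℚ.*-monoˡ-≤-nonNeg ε {{ℚ.nonNegative (ℚ.<⇒≤ 0<ε)}} 1/ε≤G))
                                         (G→∞ (ℚ.1/ ε))
        where
        instance
          ε≢0 : ℚ.NonZero ε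
          ε≢0 = ℚ.pos⇒nonZero ε {{ℚ.positive 0<ε}}

  private
    ∣u*x∣≡∣x∣ : ∀ {u} x → ∣ u ∣ ≡ 1ℚ → ∣ u * x ∣ ≡ ∣ x ∣
    ∣u*x∣≡∣x∣ {u} x ∣u∣≡1 = trans (∣x*y∣≡∣x∣*∣y∣ u x) (trans (cong (_* ∣ x ∣) ∣u∣≡1) (ℚ.*-identityˡ (∣ x ∣)))

  recurrence-growth : ∀ {t d z} → ∣ d ∣ ≡ 1ℚ → 1ℚ < ∣ t ∣ → LinearRecurrence t d z →
                      ∣ z 0 ∣ ≤ ∣ z 1 ∣ → z 1 ≢ 0ℚ → ∀ n → ∣ z (suc n) ∣ ≡ powℚ (∣ t ∣) n * ∣ z 1 ∣
  recurrence-growth {t} {d} {z} ∣d∣≡1 1<∣t∣ rec ∣z0∣≤∣z1∣ z1≢0 n = proj₂ (invariant n)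
    where
    invariant : ∀ n → ∣ z n ∣ ≤ ∣ z (suc n) ∣ × ∣ z (suc n) ∣ ≡ powℚ (∣ t ∣) n * ∣ z 1 ∣
    invariant zero    = ∣z0∣≤∣z1∣ , sym (ℚ.*-identityˡ (∣ z 1 ∣))
    invariant (suc n) = ℚ.≤-trans (ℚ.<⇒≤ ∣zₙ₊₁∣<∣tzₙ₊₁∣) (ℚ.≤-reflexive (sym ∣zₙ₊₂∣≡)) , (begin-equality
      ∣ z (suc (suc n)) ∣                    ≡⟨ ∣zₙ₊₂∣≡ ⟩
      ∣ t * z (suc n) ∣                      ≡⟨ ∣x*y∣≡∣x∣*∣y∣ t (z (suc n)) ⟩
      ∣ t ∣ * ∣ z (suc n) ∣                  ≡⟨ cong (∣ t ∣ *_) (proj₂ (invariant n)) ⟩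
      ∣ t ∣ * (powℚ (∣ t ∣) n * ∣ z 1 ∣)        ≡⟨ sym (ℚ.*-assoc (∣ t ∣) (powℚ (∣ t ∣) n) (∣ z 1 ∣)) ⟩
      powℚ (∣ t ∣) (suc n) * ∣ z 1 ∣            ∎)
      where
      open ℚ.≤-Reasoning
      0<∣zₙ₊₁∣ : 0ℚ < ∣ z (suc n) ∣
      0<∣zₙ₊₁∣ = subst (0ℚ <_) (sym (proj₂ (invariant n)))
        (*-pos (pow-pos n (ℚ.<-trans 0<1 1<∣t∣)) (x≢0⇒0<∣x∣ z1≢0))
      ∣zₙ₊₁∣<∣tzₙ₊₁∣ : ∣ z (suc n) ∣ < ∣ t * z (suc n) ∣
      ∣zₙ₊₁∣<∣tzₙ₊₁∣ = subst₂ _<_ (ℚ.*-identityˡ _) (sym (∣x*y∣≡∣x∣*∣y∣ t (z (suc n))))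
        (ℚ.*-monoˡ-<-pos (∣ z (suc n) ∣) {{ℚ.positive 0<∣zₙ₊₁∣}} 1<∣t∣)
      ∣zₙ₊₂∣≡ : ∣ z (suc (suc n)) ∣ ≡ ∣ t * z (suc n) ∣
      ∣zₙ₊₂∣≡ = trans (cong ∣_∣ (rec n)) (∣x-y∣≡∣x∣ (subst (_< ∣ t * z (suc n) ∣) (sym (∣u*x∣≡∣x∣ (z n) ∣d∣≡1))
                 (ℚ.≤-<-trans (proj₁ (invariant n)) ∣zₙ₊₁∣<∣tzₙ₊₁∣)))

  recurrence-bounded : ∀ {t d z} → ∣ d ∣ ≡ 1ℚ → ∣ t ∣ ≤ 1ℚ → LinearRecurrence t d z → ∀ n → ∣ z n ∣ ≤ ∣ z 0 ∣ ⊔ ∣ z 1 ∣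
  recurrence-bounded {t} {d} {z} ∣d∣≡1 ∣t∣≤1 rec n = proj₁ (invariant n)
    where
    K = ∣ z 0 ∣ ⊔ ∣ z 1 ∣
    invariant : ∀ n → ∣ z n ∣ ≤ K × ∣ z (suc n) ∣ ≤ K
    invariant zero    = ℚ.p≤p⊔q (∣ z 0 ∣) (∣ z 1 ∣) , ℚ.p≤q⊔p (∣ z 0 ∣) (∣ z 1 ∣)
    invariant (suc n) = proj₂ (invariant n) , subst (_≤ K) (cong ∣_∣ (sym (rec n)))
      (ℚ.≤-trans (∣x-y∣≤∣x∣⊔∣y∣ (t * z (suc n)) (d * z n)) (ℚ.⊔-lub ∣tzₙ₊₁∣≤K ∣dzₙ∣≤K))
      where
      ∣tzₙ₊₁∣≤K : ∣ t * z (suc n) ∣ ≤ K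
      ∣tzₙ₊₁∣≤K = subst (∣ t * z (suc n) ∣ ≤_) (ℚ.*-identityˡ K) (∣x*y∣≤ ∣t∣≤1 (proj₂ (invariant n)))
      ∣dzₙ∣≤K : ∣ d * z n ∣ ≤ K
      ∣dzₙ∣≤K = subst (_≤ K) (sym (∣u*x∣≡∣x∣ (z n) ∣d∣≡1)) (proj₁ (invariant n))

  ∣det-M∣≡1 : ∀ xs → ∣ det (M xs) ∣ ≡ 1ℚ
  ∣det-M∣≡1 []       = ∣1∣≡1
  ∣det-M∣≡1 (x ∷ xs) = trans (cong ∣_∣ (det-M-∷ x xs)) (trans (∣-x∣≡∣x∣ (det (M xs))) (∣det-M∣≡1 xs))

  height-scale : ∀ a b s → height (a * s , b * s) ≡ height (a , b) * ∣ s ∣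
  height-scale a b s = trans (cong₂ _⊔_ (∣x*y∣≡∣x∣*∣y∣ a s) (∣x*y∣≡∣x∣*∣y∣ b s))
    (sym (ℚ.*-distribʳ-⊔-nonNeg (∣ s ∣) {{ℚ.nonNegative (0≤∣x∣ s)}} (∣ a ∣) (∣ b ∣)))

  height-column₁-upper : ∀ X W → e21 W ≡ 0ℚ → height (column₁ (X ⊗ W)) ≡ height (column₁ X) * ∣ e11 W ∣
  height-column₁-upper X W γ≡0 = trans (cong height (column₁-⊗-upper X W γ≡0)) (height-scale (e11 X) (e21 X) (e11 W))

  height-column₂-⊗ : ∀ X W → height (column₂ (X ⊗ W)) ≤ (height (column₁ X) * ∣ e12 W ∣) ⊔ (height (column₂ X) * ∣ e22 W ∣)
  height-column₂-⊗ X W = ℚ.⊔-lub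
    (∣xy+zw∣≤ (ℚ.p≤p⊔q (∣ e11 X ∣) (∣ e21 X ∣)) ℚ.≤-refl (ℚ.p≤p⊔q (∣ e12 X ∣) (∣ e22 X ∣)) ℚ.≤-refl)
    (∣xy+zw∣≤ (ℚ.p≤q⊔p (∣ e11 X ∣) (∣ e21 X ∣)) ℚ.≤-refl (ℚ.p≤q⊔p (∣ e12 X ∣) (∣ e22 X ∣)) ℚ.≤-refl)

  heightProduct : Mat → ℚ
  heightProduct X = height (column₁ X) * height (column₂ X)

  module _ (c : ℕ → ℚ) where
    open ContinuedFraction c

    ∣cross-convergents∣≡1 : ∀ n → ∣ cross (convergent n) (convergent (suc n)) ∣ ≡ 1ℚ
    ∣cross-convergents∣≡1 n = begin
      ∣ cross (convergent n) (convergent (suc n)) ∣  ≡⟨ cong ∣_∣ (cong₂ cross (sym (column₂-convergentMatrix n))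
                                                                               (sym (column₁-convergentMatrix (suc n)))) ⟩
      ∣ cross (column₂ X) (column₁ X) ∣              ≡⟨ cong ∣_∣ (cross-columns X) ⟩
      ∣ - det X ∣                                    ≡⟨ ∣-x∣≡∣x∣ (det X) ⟩
      ∣ det X ∣                                      ≡⟨ ∣det-M∣≡1 (segment 1 (suc n)) ⟩
      1ℚ                                             ∎
      where
      open ≡-Reasoning
      X = convergentMatrix (suc n)

    0<height-convergent : ∀ n → 0ℚ < height (convergent n)
    0<height-convergent n = 1≤a*b⇒0<a (0≤height (convergent (suc n)))
      (subst (_≤ height (convergent n) * height (convergent (suc n))) (∣cross-convergents∣≡1 n)
        (∣cross∣≤height*height (convergent n) (convergent (suc n))))

    heights→∞⇒convergent : TendsToInfinity (λ n → height (convergent n)) → Convergent convergent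
    heights→∞⇒convergent H→∞ = Equivalence.from (convergent⇔consecutiveHeights→∞ ∣cross-convergents∣≡1) (→∞-* H→∞ (→∞-∘ ℕ.n≤1+n H→∞))

    convergent⇒heightProducts→∞ : Convergent convergent → TendsToInfinity (λ n → heightProduct (convergentMatrix n))
    convergent⇒heightProducts→∞ conv = →∞-suc⁻ (→∞-mono G≤ (Equivalence.to (convergent⇔consecutiveHeights→∞ ∣cross-convergents∣≡1) conv))
      where
      G≤ : ∀ n → height (convergent n) * height (convergent (suc n)) ≤ heightProduct (convergentMatrix (suc n))
      G≤ n = ℚ.≤-reflexive (trans (ℚ.*-comm (height (convergent n)) (height (convergent (suc n))))
        (sym (cong₂ (λ x y → height x * height y) (column₁-convergentMatrix (suc n)) (column₂-convergentMatrix n))))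

  height-column₁-antitone : ∀ (X : ℕ → Mat) W → (∀ n → X (suc n) ≡ X n ⊗ W) → e21 W ≡ 0ℚ → ∣ e11 W ∣ ≤ 1ℚ →
                            ∀ n → height (column₁ (X n)) ≤ height (column₁ (X 0))
  height-column₁-antitone X W X-suc γ≡0 ∣α∣≤1 zero    = ℚ.≤-refl
  height-column₁-antitone X W X-suc γ≡0 ∣α∣≤1 (suc n) = begin
    height (column₁ (X (suc n)))            ≡⟨ cong (λ Y → height (column₁ Y)) (X-suc n) ⟩
    height (column₁ (X n ⊗ W))              ≡⟨ height-column₁-upper (X n) W γ≡0 ⟩
    height (column₁ (X n)) * ∣ e11 W ∣      ≤⟨ ℚ.*-monoˡ-≤-nonNeg (height (column₁ (X n))) {{ℚ.nonNegative (0≤height (column₁ (X n)))}} ∣α∣≤1 ⟩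
    height (column₁ (X n)) * 1ℚ             ≡⟨ ℚ.*-identityʳ (height (column₁ (X n))) ⟩
    height (column₁ (X n))                  ≤⟨ height-column₁-antitone X W X-suc γ≡0 ∣α∣≤1 n ⟩
    height (column₁ (X 0))                  ∎
    where open ℚ.≤-Reasoning

  -- The first column height shrinks by ∣α∣ ≤ 1 per step and the second grows by at most ∣δ∣ = 1/∣α∣
  -- (plus a term that shrinks like ∣α∣ⁿ), so their product stays bounded.
  heightProduct-bounded : ∀ (X : ℕ → Mat) W → (∀ n → X (suc n) ≡ X n ⊗ W) → e21 W ≡ 0ℚ →
                          ∣ e11 W ∣ ≤ 1ℚ → ∣ e11 W ∣ * ∣ e22 W ∣ ≡ 1ℚ → ∃[ K ] ∀ n → heightProduct (X n) ≤ K
  heightProduct-bounded X W X-suc γ≡0 ∣α∣≤1 ∣α∣∣δ∣≡1 = K , bound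
    where
    open ℚ.≤-Reasoning
    open ℚ-Solver.+-*-Solver
    α = e11 W
    β = e12 W
    δ = e22 W
    a b : ℕ → ℚ
    a n = height (column₁ (X n))
    b n = height (column₂ (X n))
    K = (a 0 * a 0 * ∣ β ∣) ⊔ (a 0 * b 0)
    0≤a : ∀ n → 0ℚ ≤ a n
    0≤a n = 0≤height (column₁ (X n))
    a-suc : ∀ n → a (suc n) ≡ a n * ∣ α ∣
    a-suc n = trans (cong (λ Y → height (column₁ Y)) (X-suc n)) (height-column₁-upper (X n) W γ≡0)
    b-suc : ∀ n → b (suc n) ≤ (a n * ∣ β ∣) ⊔ (b n * ∣ δ ∣)
    b-suc n = subst (λ Y → height (column₂ Y) ≤ (a n * ∣ β ∣) ⊔ (b n * ∣ δ ∣)) (sym (X-suc n)) (height-column₂-⊗ (X n) W)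
    a≤a₀ : ∀ n → a n ≤ a 0
    a≤a₀ = height-column₁-antitone X W X-suc γ≡0 ∣α∣≤1
    bound : ∀ n → a n * b n ≤ K
    bound zero    = ℚ.p≤q⊔p (a 0 * a 0 * ∣ β ∣) (a 0 * b 0)
    bound (suc n) = begin
      a (suc n) * b (suc n)                                               ≤⟨ ℚ.*-monoˡ-≤-nonNeg (a (suc n)) {{ℚ.nonNegative (0≤a (suc n))}} (b-suc n) ⟩
      a (suc n) * ((a n * ∣ β ∣) ⊔ (b n * ∣ δ ∣))                          ≡⟨ ℚ.*-distribˡ-⊔-nonNeg (a (suc n)) {{ℚ.nonNegative (0≤a (suc n))}} _ _ ⟩
      (a (suc n) * (a n * ∣ β ∣)) ⊔ (a (suc n) * (b n * ∣ δ ∣))            ≤⟨ ℚ.⊔-lub (ℚ.≤-trans first (ℚ.p≤p⊔q _ (a 0 * b 0))) second ⟩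
      K                                                                   ∎
      where
      first : a (suc n) * (a n * ∣ β ∣) ≤ a 0 * a 0 * ∣ β ∣
      first = subst (a (suc n) * (a n * ∣ β ∣) ≤_) (sym (ℚ.*-assoc (a 0) (a 0) (∣ β ∣)))
        (*-mono-≤-nonNeg (0≤a (suc n)) (*-nonNeg (0≤a n) (0≤∣x∣ β)) (a≤a₀ (suc n))
          (ℚ.*-monoʳ-≤-nonNeg (∣ β ∣) {{ℚ.nonNegative (0≤∣x∣ β)}} (a≤a₀ n)))
      second : a (suc n) * (b n * ∣ δ ∣) ≤ K
      second = begin
        a (suc n) * (b n * ∣ δ ∣)          ≡⟨ cong (_* (b n * ∣ δ ∣)) (a-suc n) ⟩
        a n * ∣ α ∣ * (b n * ∣ δ ∣)        ≡⟨ solve 4 (λ x y u w → x :* u :* (y :* w) := x :* y :* (u :* w)) refl (a n) (b n) (∣ α ∣) (∣ δ ∣) ⟩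
        a n * b n * (∣ α ∣ * ∣ δ ∣)        ≡⟨ trans (cong (a n * b n *_) ∣α∣∣δ∣≡1) (ℚ.*-identityʳ (a n * b n)) ⟩
        a n * b n                          ≤⟨ bound n ⟩
        K                                  ∎

  module Periodic (c : ℕ → ℚ) (k : ℕ) .{{_ : NonZero k}} (c-periodic : ∀ n → c (suc n ℕ.+ k) ≡ c (suc n)) where
    open ContinuedFraction c
    open PeriodicContinuedFraction c k c-periodic

    t d : ℚ
    t = tr monodromy
    d = det monodromy

    ∣d∣≡1 : ∣ d ∣ ≡ 1ℚ
    ∣d∣≡1 = ∣det-M∣≡1 (segment 1 k)

    recurrence₁₁ : ∀ r → LinearRecurrence t d (λ n → e11 (residue r n))
    recurrence₁₁ r n = cong e11 (residue-recurrence r n)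

    recurrence₁₂ : ∀ r → LinearRecurrence t d (λ n → e12 (residue r n))
    recurrence₁₂ r n = cong e12 (residue-recurrence r n)

    recurrence₂₁ : ∀ r → LinearRecurrence t d (λ n → e21 (residue r n))
    recurrence₂₁ r n = cong e21 (residue-recurrence r n)

    recurrence₂₂ : ∀ r → LinearRecurrence t d (λ n → e22 (residue r n))
    recurrence₂₂ r n = cong e22 (residue-recurrence r n)

    ∣window-diagonal∣≡1 : ∀ r → e21 (windowMatrix r) ≡ 0ℚ → ∣ e11 (windowMatrix r) ∣ * ∣ e22 (windowMatrix r) ∣ ≡ 1ℚ
    ∣window-diagonal∣≡1 r γ≡0 = trans (sym (∣x*y∣≡∣x∣*∣y∣ (e11 (windowMatrix r)) (e22 (windowMatrix r))))
      (trans (cong ∣_∣ (sym (det-upper (windowMatrix r) γ≡0))) (∣det-M∣≡1 (segment (suc r) k)))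

    ¬convergent-if-bounded : ∀ r K → (∀ n → heightProduct (residue r n) ≤ K) → ¬ Convergent convergent
    ¬convergent-if-bounded r K bounded conv =
      →∞-unbounded (→∞-∘ (λ n → ℕ.≤-trans (ℕ.m≤m*n n k) (ℕ.m≤m+n (n ℕ.* k) r)) (convergent⇒heightProducts→∞ c conv)) K bounded

    bounded-if-∣t∣≤1 : ∣ t ∣ ≤ 1ℚ → ∃[ K ] ∀ n → heightProduct (residue 0 n) ≤ K
    bounded-if-∣t∣≤1 ∣t∣≤1 = (K e11 ⊔ K e21) * (K e12 ⊔ K e22) , λ n →
      *-mono-≤-nonNeg (0≤height (column₁ (residue 0 n))) (0≤height (column₂ (residue 0 n)))
        (ℚ.⊔-mono-≤ (bounded (recurrence₁₁ 0) n) (bounded (recurrence₂₁ 0) n))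
        (ℚ.⊔-mono-≤ (bounded (recurrence₁₂ 0) n) (bounded (recurrence₂₂ 0) n))
      where
      K : (Mat → ℚ) → ℚ
      K e = ∣ e (residue 0 0) ∣ ⊔ ∣ e (residue 0 1) ∣
      bounded : ∀ {z} → LinearRecurrence t d z → ∀ n → ∣ z n ∣ ≤ ∣ z 0 ∣ ⊔ ∣ z 1 ∣
      bounded = recurrence-bounded ∣d∣≡1 ∣t∣≤1

    bounded-if-upper : ∀ r → e21 (windowMatrix r) ≡ 0ℚ → 1ℚ ≤ ∣ e22 (windowMatrix r) ∣ → ∃[ K ] ∀ n → heightProduct (residue r n) ≤ K
    bounded-if-upper r γ≡0 1≤∣δ∣ = heightProduct-bounded (residue r) (windowMatrix r) (residue-suc-right r) γ≡0
      (a*b≡1⇒a≤1 (0≤∣x∣ (e11 (windowMatrix r))) 1≤∣δ∣ (∣window-diagonal∣≡1 r γ≡0)) (∣window-diagonal∣≡1 r γ≡0)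

    private
      0<height-residue₀ : ∀ r → 0ℚ < height (column₁ (residue r 0))
      0<height-residue₀ r = subst (λ x → 0ℚ < height x) (sym (column₁-convergentMatrix r)) (0<height-convergent c r)

    residue→∞-upper : ∀ r → e21 (windowMatrix r) ≡ 0ℚ → ∣ e22 (windowMatrix r) ∣ < 1ℚ →
                      TendsToInfinity (λ n → height (column₁ (residue r n)))
    residue→∞-upper r γ≡0 ∣δ∣<1 = →∞-geometric 1<∣α∣ (0<height-residue₀ r) 0<1 growth
      where
      α = e11 (windowMatrix r)
      1<∣α∣ : 1ℚ < ∣ α ∣
      1<∣α∣ = a*b≡1⇒1<a (0≤∣x∣ (e22 (windowMatrix r))) ∣δ∣<1 (∣window-diagonal∣≡1 r γ≡0)
      growth : ∀ n → height (column₁ (residue r 0)) * powℚ (∣ α ∣) n ≤ 1ℚ * height (column₁ (residue r n))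
      growth n = ℚ.≤-reflexive (trans (closed-form n) (sym (ℚ.*-identityˡ _)))
        where
        closed-form : ∀ n → height (column₁ (residue r 0)) * powℚ (∣ α ∣) n ≡ height (column₁ (residue r n))
        closed-form zero    = ℚ.*-identityʳ _
        closed-form (suc n) = begin
          h₀ * (∣ α ∣ * powℚ (∣ α ∣) n)                  ≡⟨ solve 3 (λ h a p → h :* (a :* p) := h :* p :* a) refl h₀ (∣ α ∣) (powℚ (∣ α ∣) n) ⟩
          h₀ * powℚ (∣ α ∣) n * ∣ α ∣                     ≡⟨ cong (_* ∣ α ∣) (closed-form n) ⟩
          height (column₁ (residue r n)) * ∣ α ∣       ≡⟨ sym (height-column₁-upper (residue r n) (windowMatrix r) γ≡0) ⟩
          height (column₁ (residue r n ⊗ windowMatrix r)) ≡⟨ cong (λ X → height (column₁ X)) (sym (residue-suc-right r n)) ⟩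
          height (column₁ (residue r (suc n)))         ∎
          where
          open ≡-Reasoning
          open ℚ-Solver.+-*-Solver
          h₀ = height (column₁ (residue r 0))

    residue→∞-lower : 1ℚ < ∣ t ∣ → ∀ r → e21 (windowMatrix r) ≢ 0ℚ → TendsToInfinity (λ n → height (column₁ (residue r n)))
    residue→∞-lower 1<∣t∣ r γ≢0 = →∞-suc⁻ (→∞-geometric 1<∣t∣ (x≢0⇒0<∣x∣ γ≢0) (0<height-residue₀ r) growth)
      where
      γ = e21 (windowMatrix r)
      u = column₁ (residue r 0)
      Y : ℕ → ℚ
      Y n = cross u (column₁ (residue r n))
      Y₁≡ : Y 1 ≡ γ * det (residue r 0)
      Y₁≡ = trans (cong (λ X → cross u (column₁ X)) (residue-suc-right r 0)) (cross-column₁-⊗ (residue r 0) (windowMatrix r))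
      ∣Y₁∣≡∣γ∣ : ∣ Y 1 ∣ ≡ ∣ γ ∣
      ∣Y₁∣≡∣γ∣ = trans (cong ∣_∣ Y₁≡) (trans (∣x*y∣≡∣x∣*∣y∣ γ (det (residue r 0)))
        (trans (cong (∣ γ ∣ *_) (∣det-M∣≡1 (segment 1 r))) (ℚ.*-identityʳ (∣ γ ∣))))
      Y₁≢0 : Y 1 ≢ 0ℚ
      Y₁≢0 Y₁≡0 = <⇒≱ (x≢0⇒0<∣x∣ γ≢0) (ℚ.≤-reflexive (trans (sym ∣Y₁∣≡∣γ∣) (trans (cong ∣_∣ Y₁≡0) ∣0∣≡0)))
      ∣Y₀∣≤∣Y₁∣ : ∣ Y 0 ∣ ≤ ∣ Y 1 ∣
      ∣Y₀∣≤∣Y₁∣ = subst (_≤ ∣ Y 1 ∣) (sym (trans (cong ∣_∣ (cross-self u)) ∣0∣≡0)) (0≤∣x∣ (Y 1))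
      ∣Yₙ₊₁∣≡ : ∀ n → ∣ Y (suc n) ∣ ≡ powℚ (∣ t ∣) n * ∣ Y 1 ∣
      ∣Yₙ₊₁∣≡ = recurrence-growth {t} {d} {Y} ∣d∣≡1 1<∣t∣
        (recurrence-cross {t} {d} u (λ n → column₁ (residue r n)) (recurrence₁₁ r) (recurrence₂₁ r)) ∣Y₀∣≤∣Y₁∣ Y₁≢0
      growth : ∀ n → ∣ γ ∣ * powℚ (∣ t ∣) n ≤ height u * height (column₁ (residue r (suc n)))
      growth n = begin
        ∣ γ ∣ * powℚ (∣ t ∣) n      ≡⟨ trans (ℚ.*-comm (∣ γ ∣) (powℚ (∣ t ∣) n)) (cong (powℚ (∣ t ∣) n *_) (sym ∣Y₁∣≡∣γ∣)) ⟩
        powℚ (∣ t ∣) n * ∣ Y 1 ∣    ≡⟨ sym (∣Yₙ₊₁∣≡ n) ⟩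
        ∣ Y (suc n) ∣             ≤⟨ ∣cross∣≤height*height u (column₁ (residue r (suc n))) ⟩
        height u * height (column₁ (residue r (suc n))) ∎
        where open ℚ.≤-Reasoning

    WindowCondition : ℕ → Set
    WindowCondition r = e21 (windowMatrix r) ≡ 0ℚ → ∣ e22 (windowMatrix r) ∣ < 1ℚ

    heights→∞ : 1ℚ < ∣ t ∣ → (∀ r → r ℕ.< k → WindowCondition r) → TendsToInfinity (λ n → height (convergent n))
    heights→∞ 1<∣t∣ windows = →∞-residues {λ n → height (convergent n)} k λ r r<k →
      →∞-mono {λ n → height (column₁ (residue r n))} {λ n → height (convergent (n ℕ.* k ℕ.+ r))}
        (λ n → ℚ.≤-reflexive (cong height (column₁-convergentMatrix (n ℕ.* k ℕ.+ r)))) (residue→∞ r (windows r r<k))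
      where
      residue→∞ : ∀ r → WindowCondition r → TendsToInfinity (λ n → height (column₁ (residue r n)))
      residue→∞ r window with e21 (windowMatrix r) ℚ.≟ 0ℚ
      ... | yes γ≡0 = residue→∞-upper r γ≡0 (window γ≡0)
      ... | no  γ≢0 = residue→∞-lower 1<∣t∣ r γ≢0

    convergent⇔1<∣t∣×windows : Convergent convergent ⇔ (1ℚ < ∣ t ∣ × (∀ r → r ℕ.< k → WindowCondition r))
    convergent⇔1<∣t∣×windows = mk⇔ (λ conv → 1<∣t∣ conv , λ r _ → window-condition conv r)
                      (λ (1<∣t∣ , windows) → heights→∞⇒convergent c (heights→∞ 1<∣t∣ windows))
      where
      1<∣t∣ : Convergent convergent → 1ℚ < ∣ t ∣
      1<∣t∣ conv with 1ℚ ℚ.<? ∣ t ∣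
      ... | yes 1<∣t∣ = 1<∣t∣
      ... | no  1≮∣t∣ = contradiction conv (uncurry (¬convergent-if-bounded 0) (bounded-if-∣t∣≤1 (ℚ.≮⇒≥ 1≮∣t∣)))
      window-condition : Convergent convergent → ∀ r → WindowCondition r
      window-condition conv r γ≡0 with ∣ e22 (windowMatrix r) ∣ ℚ.<? 1ℚ
      ... | yes ∣δ∣<1 = ∣δ∣<1
      ... | no  ∣δ∣≮1 = contradiction conv (uncurry (¬convergent-if-bounded r) (bounded-if-upper r γ≡0 (ℚ.≮⇒≥ ∣δ∣≮1)))

periodic-shift : ∀ k .{{_ : NonZero k}} (a : Fin k → ℚ) n → periodic k a (suc n ℕ.+ k) ≡ periodic k a (suc n)
periodic-shift k a n = cong a (Fin.fromℕ<-cong _ _ ([m+n]%n≡m%n n k) _ _)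
  where open import Data.Nat.DivMod using ([m+n]%n≡m%n)

∀<⇔∀Fin : ∀ {k} {P : ℕ → Set} → (∀ r → r ℕ.< k → P r) ⇔ (∀ (j : Fin k) → P (toℕ j))
∀<⇔∀Fin {P = P} = mk⇔ (λ h j → h (toℕ j) (Fin.toℕ<n j)) (λ h r r<k → subst P (Fin.toℕ-fromℕ< r<k) (h (Fin.fromℕ< r<k)))

theorem3p1 : (p : ℕ) → Prime p → p ≢ 2 →
    (k : ℕ) .{{_ : NonZero k}} → (a : Fin k → ℚ) → (∀ i → InZ1p p (a i)) →
    PAdicConvergent p (periodic k a)
      ⇔ ((1ℚ < pabs p (A (periodic k a) k + B (periodic k a) (k ∸ 1)))
         × (∀ (j : Fin k) →
              e21 (M (window k a (suc (toℕ j)))) ≡ 0ℚ →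
              pabs p (e22 (M (window k a (suc (toℕ j))))) < 1ℚ))
theorem3p1 0               ()
theorem3p1 1               ()
theorem3p1 p@(suc (suc q)) isPrime _ k@(suc k′) a _ =
  ⇔.trans convergent⇔1<∣t∣×windows (mk⇔ (subst (1ℚ <_) ∣t∣≡) (subst (1ℚ <_) (sym ∣t∣≡)) ×-⇔ ∀<⇔∀Fin {P = WindowCondition})
  where
  open NonArchimedean (PAdicAbsoluteValue.pabs-isNonArchimedeanAbsoluteValue q isPrime)
  open ContinuedFraction (periodic k a)
  open Periodic (periodic k a) k (periodic-shift k a)
  ∣t∣≡ : pabs p (tr (convergentMatrix k)) ≡ pabs p (A (periodic k a) k + B (periodic k a) k′)
  ∣t∣≡ = cong (λ X → pabs p (tr X)) (convergentMatrix-suc k′)
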